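{- Let $n,k$ be integers with $n\geq k\geq 3$ and let $T$ be a tree of order $n$. Then $$Sd_k(T)\leq \frac{k}{k-2}\,Sr_{k,2}(T)-\frac{2}{k-2}.$$ Moreover, equality holds if $T\cong P_2(a,b;x)$, where $x$ is a positive integer such that $\frac{n-2}{x}$ is an integer and $a,b$ are positive integers with $a+b=\frac{n-2}{x}\geq k$.
   Context: All graphs are finite, simple and connected. For a graph $G$ and $S\subseteq V(G)$, the Steiner distance $d_G(S)$ is the minimum number of edges of a connected subgraph of $G$ (equivalently, of a subtree of $G$) whose vertex set contains $S$. For integers $k\geq 2$, $1\leq k'\leq k$, $|V(G)|\geq k$, and a $k'$-subset $S'\subseteq V(G)$, the Steiner $(k,k')$-eccentricity of $S'$ is $\varepsilon_{k,k'}(S';G)=\max\{d_G(S): S'\subseteq S\subseteq V(G),\ |S|=k\}$. The Steiner $k$-eccentricity of a vertex $v$ is $\varepsilon_k(v;G)=\varepsilon_{k,1}(\{v\};G)$. The Steiner $k$-diameter is $Sd_k(G)=\max\{\varepsilon_k(v;G): v\in V(G)\}$, and the Steiner $(k,k')$-radius is $Sr_{k,k'}(G)=\min\{\varepsilon_{k,k'}(S';G): S'\subseteq V(G),\ |S'|=k'\}$. For positive integers $a,b,l,x$, the graph $P_l(a,b;x)$ is obtained from the path $P_l$ on $l$ vertices by attaching $a$ pendant paths of length $x$ at one end vertex of $P_l$ and $b$ pendant paths of length $x$ at the other end vertex (so $P_2(a,b;x)$ has order $2+(a+b)x$). -}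

module Defs where

open import Data.Nat using (ℕ; zero; suc; _+_; _*_; _∸_; _≤_; _<ᵇ_; _≡ᵇ_)
open import Data.Nat.Divisibility using (_∣?_)
open import Data.Bool using (Bool; true; false; if_then_else_; _∧_; _∨_)
open import Data.Fin using (Fin; toℕ)
open import Data.Fin.Subset using (Subset; _∈_; _⊆_; ∣_∣; ⁅_⁆)
open import Data.List using (List; []; _∷_; _++_; length; map; allFin)
open import Data.Nat.ListAction using (sum)
open import Data.List.Relation.Unary.Unique.Propositional using (Unique)
open import Data.Product using (Σ; _×_; ∃)
open import Data.Empty using (⊥)
open import Function.Bundles using (_↔_; Inverse)
open import Relation.Binary.PropositionalEquality using (_≡_)
open import Relation.Nullary.Decidable using (⌊_⌋)

Graph : ℕ → Set
Graph n = Fin n → Fin n → Bool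

module _ {n : ℕ} where

  IsSimple : Graph n → Set
  IsSimple G = (∀ i j → G i j ≡ G j i) × (∀ i → G i i ≡ false)

  data Walk (E : Graph n) : Fin n → Fin n → Set where
    here : ∀ {u} → Walk E u u
    step : ∀ {u v w} → E u v ≡ true → Walk E v w → Walk E u w

  Connected : Graph n → Set
  Connected G = ∀ u v → Walk G u v

  data Chain (G : Graph n) : List (Fin n) → Set where
    one  : ∀ v → Chain G (v ∷ [])
    cons : ∀ u v vs → G u v ≡ true → Chain G (v ∷ vs) → Chain G (u ∷ v ∷ vs)

  Acyclic : Graph n → Set
  Acyclic G = ∀ u ws → 2 ≤ length ws → Unique (u ∷ ws) → Chain G (u ∷ ws ++ u ∷ []) → ⊥

  IsTree : Graph n → Set
  IsTree G = IsSimple G × Connected G × Acyclic G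

  edgeCount : Graph n → ℕ
  edgeCount E = sum (map (λ i → sum (map (λ j →
    if (toℕ i <ᵇ toℕ j) ∧ E i j then 1 else 0) (allFin n))) (allFin n))

  record ConnSubgraph (G : Graph n) (S : Subset n) : Set where
    field
      Vs    : Subset n
      E     : Graph n
      E⊆G   : ∀ i j → E i j ≡ true → G i j ≡ true
      Esym  : ∀ i j → E i j ≡ E j i
      Eends : ∀ i j → E i j ≡ true → i ∈ Vs
      S⊆Vs  : S ⊆ Vs
      conn  : ∀ u v → u ∈ Vs → v ∈ Vs → Walk E u v

  IsSteinerDist : Graph n → Subset n → ℕ → Set
  IsSteinerDist G S d =
    (Σ (ConnSubgraph G S) λ H → edgeCount (ConnSubgraph.E H) ≡ d)
    × (∀ (H : ConnSubgraph G S) → d ≤ edgeCount (ConnSubgraph.E H))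

  IsSteinerEcc : Graph n → ℕ → Subset n → ℕ → Set
  IsSteinerEcc G k S' e =
    (∃ λ S → S' ⊆ S × ∣ S ∣ ≡ k × IsSteinerDist G S e)
    × (∀ S d → S' ⊆ S → ∣ S ∣ ≡ k → IsSteinerDist G S d → d ≤ e)

  IsSteinerDiam : Graph n → ℕ → ℕ → Set
  IsSteinerDiam G k D =
    (∃ λ v → IsSteinerEcc G k ⁅ v ⁆ D)
    × (∀ v e → IsSteinerEcc G k ⁅ v ⁆ e → e ≤ D)

  IsSteinerRad : Graph n → ℕ → ℕ → ℕ → Set
  IsSteinerRad G k k' R =
    (∃ λ S' → ∣ S' ∣ ≡ k' × IsSteinerEcc G k S' R)
    × (∀ S' e → ∣ S' ∣ ≡ k' → IsSteinerEcc G k S' e → R ≤ e)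

Iso : ∀ {n m} → Graph n → Graph m → Set
Iso {n} {m} G H = Σ (Fin n ↔ Fin m) λ f →
  ∀ i j → G i j ≡ H (Inverse.to f i) (Inverse.to f j)

-- P_2(a,b;x): vertices 0,1 form the path P_2 (0 ~ 1).  The (a+b) pendant
-- paths occupy vertices 2 + j*x + p (0 ≤ j < a+b, 0 ≤ p < x); vertex with
-- p = 0 is attached to 0 if j < a and to 1 otherwise; p ≥ 1 is attached to p-1.
-- parentIs a x v u : u is the parent of vertex v (v ≥ 2)
parentIs : ℕ → ℕ → ℕ → ℕ → Bool
parentIs a x zero u = false
parentIs a x (suc zero) u = false
parentIs a x (suc (suc m)) u =
  if ⌊ x ∣? m ⌋
  then (if m <ᵇ a * x then u ≡ᵇ 0 else u ≡ᵇ 1)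
  else u ≡ᵇ suc m

P2 : (a b x : ℕ) → Graph (2 + (a + b) * x)
P2 a b x i j =
  ((toℕ i ≡ᵇ 0) ∧ (toℕ j ≡ᵇ 1)) ∨ ((toℕ i ≡ᵇ 1) ∧ (toℕ j ≡ᵇ 0))
  ∨ parentIs a x (toℕ i) (toℕ j) ∨ parentIs a x (toℕ j) (toℕ i)

-- In a tree the Steiner distance of a vertex set S is the number of edges whose removal leaves
-- vertices of S on both sides: a connected subgraph containing S must contain every such edge, and
-- one can be trimmed down until it has no other edge.
--
-- Let S, |S| = k, realise the Steiner k-diameter D and {u, w} the Steiner (k,2)-radius R.  For each
-- of the k(k-1) ordered pairs s ≠ t in S the set {u, w} ∪ S ∖ {s, t} has at most k elements, so at
-- most R edges separate it.  Summing over the pairs, an edge separating {u, w} is counted k(k-1)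
-- times, and an edge separating S but not {u, w} is still counted by the (k-1)(k-2) pairs avoiding
-- a vertex of S on the far side of it.  Hence (k-1)(k-2)D + 2(k-1) ≤ k(k-1)R, since {u, w} is
-- separated by at least one edge.
--
-- For T ≅ P₂(a,b;x) with a + b ≥ k, the ends of k consecutive legs, taken on both sides of the
-- central edge, are separated by all 1 + kx edges of their legs and the central one, so D ≥ 1 + kx;
-- and a k-set containing both centres is separated only by the central edge and the at most
-- (k-2)x edges above its other k - 2 vertices, so R ≤ 1 + (k-2)x.  These bounds give the reverse
-- inequality.

module Submission where

open import Defs
open import Data.Bool using (Bool; true; false; if_then_else_; _∧_; _∨_; not)
open import Data.Bool.Properties
  using (T-≡; ∧-comm; ∨-comm; ∧-zeroʳ; ∧-identityʳ; ∨-identityʳ; ∨-zeroʳ) renaming (_≟_ to _≟ᵇ_)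
open import Data.Empty using (⊥; ⊥-elim)
open import Data.Fin using (Fin; zero; suc; toℕ; fromℕ<; remQuot)
import Data.Fin.Properties as Fin
open import Data.Fin.Subset using (Subset; _∈_; _⊆_; ∣_∣; ⁅_⁆; ⊤)
open import Data.Fin.Subset.Properties using (∈⊤; _⊆?_; anySubset?; ∣⁅x⁆∣≡1; x∈⁅y⁆⇒x≡y)
open import Data.List.Base using (List; []; _∷_; _++_)
import Data.List.Base as L using (map; allFin; tabulate)
import Data.List.Properties as L using (map-tabulate)
open import Data.List.Membership.Propositional.Properties using (∈-∃++)
import Data.List.Relation.Unary.All as All
open import Data.List.Relation.Unary.All.Properties using (¬Any⇒All¬)
open import Data.List.Relation.Unary.AllPairs using ([]; _∷_)
open import Data.List.Relation.Unary.Unique.Propositional using (Unique)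
open import Data.Nat using (ℕ; zero; suc; _+_; _*_; _∸_; _⊓_; _≤_; _<_; z≤n; s≤s; _<ᵇ_; _≡ᵇ_; _<?_)
import Data.Nat as ℕ using (_≟_)
open import Data.Nat.Divisibility using (_∣_; _∣?_; n∣m*n; ∣m+n∣m⇒∣n; ∣⇒≤)
open import Data.Nat.DivMod using (_/_; _%_; m≡m%n+[m/n]*n; m%n<n; +-distrib-/-∣ˡ; m*n/n≡m; m<n⇒m/n≡0)
open import Data.Nat.ListAction using () renaming (sum to sumᴸ)
open import Data.Nat.Properties
open import Algebra.Properties.Semiring.Sum +-*-semiring
  using (sum; sum-cong-≗; sum-replicate-zero; ∑-distrib-+; ∑-comm; *-distribˡ-sum)
open import Data.Nat.Tactic.RingSolver using (solve-∀)
open import Data.Product using (Σ; _×_; _,_; proj₁; proj₂; ∃)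
open import Data.Sum using (_⊎_; inj₁; inj₂)
open import Data.Vec.Base using ([]; _∷_; lookup; tabulate)
open import Data.Vec.Properties using (lookup⇒[]=; []=⇒lookup; lookup∘tabulate)
open import Function using (_∘_; id)
open import Function.Bundles using (Equivalence; Inverse; _↔_)
open import Relation.Binary using (tri<; tri≈; tri>)
open import Relation.Binary.PropositionalEquality
open import Relation.Nullary using (¬_; Dec; yes; no)
open import Relation.Nullary.Decidable using (⌊_⌋; ⌊⌋-map′; _×-dec_; dec-true; dec-false; isYes≗does)

𝟙 : Bool → ℕ
𝟙 b = if b then 1 else 0

𝟙≤1 : ∀ b → 𝟙 b ≤ 1
𝟙≤1 true  = ≤-refl
𝟙≤1 false = z≤n

𝟙-mono : ∀ {a b} → (a ≡ true → b ≡ true) → 𝟙 a ≤ 𝟙 b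
𝟙-mono {false} _ = z≤n
𝟙-mono {true}  h rewrite h refl = ≤-refl

𝟙-∧ : ∀ a b → 𝟙 (a ∧ b) ≡ 𝟙 a * 𝟙 b
𝟙-∧ true  b = sym (+-identityʳ (𝟙 b))
𝟙-∧ false b = refl

𝟙*-mono : ∀ b {x y} → (b ≡ true → x ≤ y) → 𝟙 b * x ≤ 𝟙 b * y
𝟙*-mono true  h = +-monoˡ-≤ 0 (h refl)
𝟙*-mono false h = z≤n

𝟙≤ : ∀ {b m} → (b ≡ true → 1 ≤ m) → 𝟙 b ≤ m
𝟙≤ {true}  h = h refl
𝟙≤ {false} h = z≤n

𝟙-∨ : ∀ a b → 𝟙 (a ∨ b) ≤ 𝟙 a + 𝟙 b
𝟙-∨ true  _ = s≤s z≤n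
𝟙-∨ false _ = ≤-refl

∧-elim : ∀ {a b} → a ∧ b ≡ true → a ≡ true × b ≡ true
∧-elim {true} {true} _ = refl , refl

∧-intro : ∀ {a b} → a ≡ true → b ≡ true → a ∧ b ≡ true
∧-intro refl refl = refl

∨-elim : ∀ {a b} → a ∨ b ≡ true → a ≡ true ⊎ b ≡ true
∨-elim {true}  _ = inj₁ refl
∨-elim {false} e = inj₂ e

∨-introˡ : ∀ {a b} → a ≡ true → a ∨ b ≡ true
∨-introˡ refl = refl

∨-introʳ : ∀ {a b} → b ≡ true → a ∨ b ≡ true
∨-introʳ {true}  _ = refl
∨-introʳ {false} e = e

not-elim : ∀ {b} → not b ≡ true → b ≡ false
not-elim {false} _ = refl

not-intro : ∀ {b} → b ≡ false → not b ≡ true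
not-intro refl = refl

true≢false : ∀ {b} → b ≡ true → b ≡ false → ⊥
true≢false refl ()

¬true⇒false : ∀ {b} → ¬ b ≡ true → b ≡ false
¬true⇒false {false} _ = refl
¬true⇒false {true}  h = ⊥-elim (h refl)

<⇒<ᵇ≡true : ∀ {m k} → m < k → (m <ᵇ k) ≡ true
<⇒<ᵇ≡true = Equivalence.to T-≡ ∘ <⇒<ᵇ

<ᵇ≡true⇒< : ∀ {m k} → (m <ᵇ k) ≡ true → m < k
<ᵇ≡true⇒< {m} {k} e = <ᵇ⇒< m k (Equivalence.from T-≡ e)

≡⇒≡ᵇ≡true : ∀ {m k} → m ≡ k → (m ≡ᵇ k) ≡ true
≡⇒≡ᵇ≡true {m} {k} e = Equivalence.to T-≡ (≡⇒≡ᵇ m k e)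

≡ᵇ≡true⇒≡ : ∀ {m k} → (m ≡ᵇ k) ≡ true → m ≡ k
≡ᵇ≡true⇒≡ {m} {k} e = ≡ᵇ⇒≡ m k (Equivalence.from T-≡ e)

≢false⇒true : ∀ {b} → ¬ b ≡ false → b ≡ true
≢false⇒true {true}  _ = refl
≢false⇒true {false} h = ⊥-elim (h refl)

⇔⇒≡ : ∀ {a b} → (a ≡ true → b ≡ true) → (b ≡ true → a ≡ true) → a ≡ b
⇔⇒≡ {true}  {b}     f g = sym (f refl)
⇔⇒≡ {false} {true}  f g = g refl
⇔⇒≡ {false} {false} f g = refl

true-or-false : ∀ b → b ≡ true ⊎ b ≡ false
true-or-false true  = inj₁ refl
true-or-false false = inj₂ refl

private variable n : ℕ

anyᵇ : (Fin n → Bool) → Bool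
anyᵇ {zero}  P = false
anyᵇ {suc n} P = P zero ∨ anyᵇ (P ∘ suc)

anyᵇ-elim : ∀ (P : Fin n → Bool) → anyᵇ P ≡ true → ∃ λ i → P i ≡ true
anyᵇ-elim {suc n} P e with ∨-elim {P zero} e
... | inj₁ p = zero , p
... | inj₂ p = let i , q = anyᵇ-elim (P ∘ suc) p in suc i , q

anyᵇ-intro : ∀ (P : Fin n → Bool) i → P i ≡ true → anyᵇ P ≡ true
anyᵇ-intro P zero    p = ∨-introˡ p
anyᵇ-intro P (suc i) p = ∨-introʳ {P zero} (anyᵇ-intro (P ∘ suc) i p)

infix 7 _==_
_==_ : Fin n → Fin n → Bool
i == j = ⌊ i Fin.≟ j ⌋

==-refl : ∀ (i : Fin n) → (i == i) ≡ true
==-refl i with i Fin.≟ i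
... | yes _  = refl
... | no i≢i = ⊥-elim (i≢i refl)

==⇒≡ : ∀ {i j : Fin n} → (i == j) ≡ true → i ≡ j
==⇒≡ {i = i} {j} e with i Fin.≟ j
... | yes i≡j = i≡j

≢⇒==-false : ∀ {i j : Fin n} → i ≢ j → (i == j) ≡ false
≢⇒==-false {i = i} {j} i≢j with i Fin.≟ j
... | yes i≡j = ⊥-elim (i≢j i≡j)
... | no _    = refl

≡⇒== : ∀ {i j : Fin n} → i ≡ j → (i == j) ≡ true
≡⇒== {i = i} refl = ==-refl i

not==⇒≢ : ∀ {i j : Fin n} → not (i == j) ≡ true → i ≢ j
not==⇒≢ {i = i} i≠j refl = true≢false (==-refl i) (not-elim i≠j)

==-sym : ∀ (i j : Fin n) → (i == j) ≡ (j == i)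
==-sym i j = ⇔⇒≡ (≡⇒== ∘ sym ∘ ==⇒≡) (≡⇒== ∘ sym ∘ ==⇒≡)

⌊⌋-true : ∀ {A : Set} (d : Dec A) → A → ⌊ d ⌋ ≡ true
⌊⌋-true d a = trans (isYes≗does d) (dec-true d a)

⌊⌋-false : ∀ {A : Set} (d : Dec A) → ¬ A → ⌊ d ⌋ ≡ false
⌊⌋-false d ¬a = trans (isYes≗does d) (dec-false d ¬a)

sum-mono : {f g : Fin n → ℕ} → (∀ i → f i ≤ g i) → sum f ≤ sum g
sum-mono {zero}  h = z≤n
sum-mono {suc n} h = +-mono-≤ (h zero) (sum-mono (h ∘ suc))

sum-mono-< : {f g : Fin n → ℕ} → (∀ i → f i ≤ g i) → ∀ a → f a < g a → sum f < sum g
sum-mono-< h zero    lt = +-mono-<-≤ lt (sum-mono (h ∘ suc))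
sum-mono-< h (suc a) lt = +-mono-≤-< (h zero) (sum-mono-< (h ∘ suc) a lt)

term≤sum : ∀ (f : Fin n → ℕ) a → f a ≤ sum f
term≤sum f zero    = m≤m+n _ _
term≤sum f (suc a) = ≤-trans (term≤sum (f ∘ suc) a) (m≤n+m _ _)

sum-pos : ∀ (f : Fin n → ℕ) → 0 < sum f → ∃ λ i → 0 < f i
sum-pos {suc n} f lt with f zero in eq
... | suc _ = zero , subst (0 <_) (sym eq) (s≤s z≤n)
... | zero  = let i , p = sum-pos (f ∘ suc) lt in suc i , p

sum-zero : sum {n} (λ _ → 0) ≡ 0
sum-zero {n} = sum-replicate-zero n

sum-scale : ∀ c (f : Fin n → ℕ) → sum (λ i → c * f i) ≡ c * sum f
sum-scale c f = sym (*-distribˡ-sum c f)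

sum-delta : ∀ (a : Fin n) (h : Fin n → ℕ) → sum (λ i → if i == a then h i else 0) ≡ h a
sum-delta {suc n} zero h = trans (cong (h zero +_) (sum-zero {n})) (+-identityʳ _)
sum-delta {suc n} (suc a) h =
  trans (sum-cong-≗ λ i → cong (λ b → if b then h (suc i) else 0) (⌊⌋-map′ (cong suc) Fin.suc-injective (i Fin.≟ a)))
        (sum-delta a (h ∘ suc))

sum₂ : (Fin n → Fin n → ℕ) → ℕ
sum₂ f = sum (λ i → sum (f i))

sum₂-mono : ∀ {f g : Fin n → Fin n → ℕ} → (∀ i j → f i j ≤ g i j) → sum₂ f ≤ sum₂ g
sum₂-mono h = sum-mono (sum-mono ∘ h)

sum₂-scale : ∀ c (f : Fin n → Fin n → ℕ) → sum₂ (λ i j → c * f i j) ≡ c * sum₂ f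
sum₂-scale c f = trans (sum-cong-≗ λ i → sum-scale c (f i)) (sum-scale c (λ i → sum (f i)))

sum₂-linear : ∀ A B (f g : Fin n → Fin n → ℕ) → sum₂ (λ i j → A * f i j + B * g i j) ≡ A * sum₂ f + B * sum₂ g
sum₂-linear A B f g = begin
  sum₂ (λ i j → A * f i j + B * g i j)
    ≡⟨ sum-cong-≗ (λ i → ∑-distrib-+ (λ j → A * f i j) (λ j → B * g i j)) ⟩
  sum (λ i → sum (λ j → A * f i j) + sum (λ j → B * g i j))
    ≡⟨ ∑-distrib-+ (λ i → sum (λ j → A * f i j)) _ ⟩
  sum₂ (λ i j → A * f i j) + sum₂ (λ i j → B * g i j)
    ≡⟨ cong₂ _+_ (sum₂-scale A f) (sum₂-scale B g) ⟩
  A * sum₂ f + B * sum₂ g ∎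
  where open ≡-Reasoning

sum₂-comm : ∀ {m} (h : Fin n → Fin n → Fin m → Fin m → ℕ) →
            sum₂ (λ p q → sum₂ (h p q)) ≡ sum₂ (λ s t → sum₂ (λ p q → h p q s t))
sum₂-comm h = begin
  sum (λ p → sum (λ q → sum (λ s → sum (h p q s))))
    ≡⟨ sum-cong-≗ (λ p → ∑-comm (λ q s → sum (h p q s))) ⟩
  sum (λ p → sum (λ s → sum (λ q → sum (h p q s))))
    ≡⟨ ∑-comm (λ p s → sum (λ q → sum (h p q s))) ⟩
  sum (λ s → sum (λ p → sum (λ q → sum (h p q s))))
    ≡⟨ sum-cong-≗ (λ s → sum-cong-≗ λ p → ∑-comm (λ q t → h p q s t)) ⟩
  sum (λ s → sum (λ p → sum (λ t → sum (λ q → h p q s t))))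
    ≡⟨ sum-cong-≗ (λ s → ∑-comm (λ p t → sum (λ q → h p q s t))) ⟩
  sum (λ s → sum (λ t → sum (λ p → sum (λ q → h p q s t)))) ∎
  where open ≡-Reasoning

count : (Fin n → Bool) → ℕ
count P = sum (λ i → 𝟙 (P i))

count-cong : ∀ {P Q : Fin n → Bool} → (∀ v → P v ≡ Q v) → count P ≡ count Q
count-cong h = sum-cong-≗ (cong 𝟙 ∘ h)

count-mono : ∀ {P Q : Fin n → Bool} → (∀ v → P v ≡ true → Q v ≡ true) → count P ≤ count Q
count-mono h = sum-mono (𝟙-mono ∘ h)

count≤n : ∀ (P : Fin n → Bool) → count P ≤ n
count≤n {zero}  P = z≤n
count≤n {suc n} P = +-mono-≤ (𝟙≤1 (P zero)) (count≤n (P ∘ suc))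

count-∨ : ∀ (P Q : Fin n → Bool) → count (λ v → P v ∨ Q v) ≤ count P + count Q
count-∨ P Q = ≤-trans (sum-mono (λ v → 𝟙-∨ (P v) (Q v))) (≤-reflexive (∑-distrib-+ (𝟙 ∘ P) (𝟙 ∘ Q)))

count-pos : ∀ (P : Fin n → Bool) → 0 < count P → ∃ λ v → P v ≡ true
count-pos P lt with sum-pos (𝟙 ∘ P) lt
... | v , p with P v in e
... | true = v , e

count-single : ∀ (a : Fin n) → count (_== a) ≡ 1
count-single a = sum-delta a (λ _ → 1)

infixl 6 _∖_
_∖_ : (Fin n → Bool) → Fin n → Fin n → Bool
(P ∖ a) v = P v ∧ not (a == v)

∖-intro : ∀ {P : Fin n → Bool} {a v} → P v ≡ true → a ≢ v → (P ∖ a) v ≡ true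
∖-intro Pv a≢v = ∧-intro Pv (not-intro (≢⇒==-false a≢v))

∖-elim : ∀ {P : Fin n → Bool} {a v} → (P ∖ a) v ≡ true → P v ≡ true × a ≢ v
∖-elim {P = P} {a} {v} e = let Pv , a≠v = ∧-elim {P v} e in
  Pv , λ a≡v → true≢false (trans (cong (_== v) a≡v) (==-refl v)) (not-elim a≠v)

count-remove : ∀ (P : Fin n → Bool) a → count P ≡ count (P ∖ a) + 𝟙 (P a)
count-remove P a = begin
  count P                                                      ≡⟨ sum-cong-≗ split-at ⟩
  sum (λ v → 𝟙 ((P ∖ a) v) + (if v == a then 𝟙 (P v) else 0)) ≡⟨ ∑-distrib-+ (𝟙 ∘ (P ∖ a)) _ ⟩
  count (P ∖ a) + sum (λ v → if v == a then 𝟙 (P v) else 0)   ≡⟨ cong (count (P ∖ a) +_) (sum-delta a (𝟙 ∘ P)) ⟩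
  count (P ∖ a) + 𝟙 (P a)                                      ∎
  where
  open ≡-Reasoning
  split : ∀ p e → 𝟙 p ≡ 𝟙 (p ∧ not e) + (if e then 𝟙 p else 0)
  split true  true  = refl
  split true  false = refl
  split false true  = refl
  split false false = refl
  split-at : ∀ v → 𝟙 (P v) ≡ 𝟙 ((P ∖ a) v) + (if v == a then 𝟙 (P v) else 0)
  split-at v = trans (split (P v) (a == v)) (cong (λ e → 𝟙 ((P ∖ a) v) + (if e then 𝟙 (P v) else 0)) (==-sym a v))

count-remove-∈ : ∀ (P : Fin n → Bool) a → P a ≡ true → count P ≡ suc (count (P ∖ a))
count-remove-∈ P a Pa = trans (count-remove P a) (trans (cong (λ b → count (P ∖ a) + 𝟙 b) Pa) (+-comm _ 1))

count<n⇒∃false : ∀ (P : Fin n → Bool) → count P < n → ∃ λ v → P v ≡ false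
count<n⇒∃false {suc n} P lt with P zero in e
... | false = zero , e
... | true  = let v , Pv = count<n⇒∃false (P ∘ suc) (≤-pred lt) in suc v , Pv

two-distinct : ∀ (P : Fin n → Bool) → 2 ≤ count P → ∃ λ u → ∃ λ w → u ≢ w × P u ≡ true × P w ≡ true
two-distinct P 2≤P with count-pos P (≤-trans (s≤s z≤n) 2≤P)
... | u , Pu with count-pos (P ∖ u) (≤-pred (subst (2 ≤_) (count-remove-∈ P u Pu) 2≤P))
... | w , Pw∖u = let Pw , u≢w = ∖-elim {P = P} Pw∖u in u , w , u≢w , Pu , Pw

count-∧ˡ : ∀ b (P : Fin n → Bool) → count (λ v → b ∧ P v) ≡ 𝟙 b * count P
count-∧ˡ true  P = sym (+-identityʳ _)
count-∧ˡ {n} false P = sum-zero {n}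

insert : Fin n → (Fin n → Bool) → Fin n → Bool
insert a P v = (v == a) ∨ P v

count-insert : ∀ (P : Fin n → Bool) a → P a ≡ false → count (insert a P) ≡ suc (count P)
count-insert P a Pa = begin
  count (insert a P)          ≡⟨ count-remove-∈ (insert a P) a (∨-introˡ (==-refl a)) ⟩
  suc (count (insert a P ∖ a)) ≡⟨ cong suc (count-cong same) ⟩
  suc (count (P ∖ a))          ≡⟨ cong suc (+-identityʳ _) ⟨
  suc (count (P ∖ a) + 0)      ≡⟨ cong suc (trans (count-remove P a) (cong (λ b → count (P ∖ a) + 𝟙 b) Pa)) ⟨
  suc (count P)                ∎
  where
  open ≡-Reasoning
  absorb : ∀ b p → (b ∨ p) ∧ not b ≡ p ∧ not b
  absorb true  p = sym (∧-zeroʳ p)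
  absorb false _ = refl
  same : ∀ v → (insert a P ∖ a) v ≡ (P ∖ a) v
  same v rewrite ==-sym a v = absorb (v == a) (P v)

extend : ∀ (X : Fin n → Bool) d → count X + d ≤ n →
         ∃ λ Y → (∀ v → X v ≡ true → Y v ≡ true) × count Y ≡ count X + d
extend X zero    _  = X , (λ _ x → x) , sym (+-identityʳ _)
extend X (suc d) le with count<n⇒∃false X (≤-trans (m<m+n _ (s≤s z≤n)) le)
... | a , Xa with extend (insert a X) d (≤-trans (≤-reflexive (trans (cong (_+ d) (count-insert X a Xa)) (sym (+-suc _ d)))) le)
... | Y , X⊆Y , |Y| =
  Y , (λ v x → X⊆Y v (∨-introʳ x)) , trans |Y| (trans (cong (_+ d) (count-insert X a Xa)) (sym (+-suc _ d)))

extend-to : ∀ (X : Fin n → Bool) {k} → count X ≤ k → k ≤ n →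
            ∃ λ Y → (∀ v → X v ≡ true → Y v ≡ true) × count Y ≡ k
extend-to X X≤k k≤n with extend X (_ ∸ count X) (≤-trans (≤-reflexive (m+[n∸m]≡n X≤k)) k≤n)
... | Y , X⊆Y , |Y| = Y , X⊆Y , trans |Y| (m+[n∸m]≡n X≤k)

count-ordered-pairs : ∀ (Y : Fin n → Bool) c → count Y ≡ suc c →
                      sum (λ s → count (λ t → Y s ∧ (Y ∖ s) t)) ≡ suc c * c
count-ordered-pairs Y c |Y| = begin
  sum (λ s → count (λ t → Y s ∧ (Y ∖ s) t)) ≡⟨ sum-cong-≗ (λ s → trans (count-∧ˡ (Y s) (Y ∖ s)) (rest s)) ⟩
  sum (λ s → c * 𝟙 (Y s))                   ≡⟨ sum-scale c (𝟙 ∘ Y) ⟩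
  c * count Y                               ≡⟨ cong (c *_) |Y| ⟩
  c * suc c                                 ≡⟨ *-comm c (suc c) ⟩
  suc c * c                                 ∎
  where
  open ≡-Reasoning
  rest : ∀ s → 𝟙 (Y s) * count (Y ∖ s) ≡ c * 𝟙 (Y s)
  rest s with Y s in Ys
  ... | false = sym (*-zeroʳ c)
  ... | true  = trans (+-identityʳ _) (trans (suc-injective (trans (sym (count-remove-∈ Y s Ys)) |Y|)) (sym (*-identityʳ c)))

image : ∀ {k} → (Fin k → Fin n) → Fin n → Bool
image g v = anyᵇ (λ t → v == g t)

count-image≤ : ∀ {k} (g : Fin k → Fin n) → count (image g) ≤ k
count-image≤ {n} {zero} g = ≤-reflexive (sum-zero {n})
count-image≤ {k = suc k} g = begin
  count (image g)
    ≤⟨ count-∨ (_== g zero) (image (g ∘ suc)) ⟩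
  count (_== g zero) + count (image (g ∘ suc))
    ≤⟨ +-mono-≤ (≤-reflexive (count-single (g zero))) (count-image≤ (g ∘ suc)) ⟩
  suc k ∎
  where open ≤-Reasoning

injection⇒≤count : ∀ {k} (g : Fin k → Fin n) → (∀ s t → g s ≡ g t → s ≡ t) →
                   ∀ (P : Fin n → Bool) → (∀ t → P (g t) ≡ true) → k ≤ count P
injection⇒≤count {k = zero}  g inj P Pg = z≤n
injection⇒≤count {k = suc k} g inj P Pg =
  subst (suc k ≤_) (sym (count-remove-∈ P (g zero) (Pg zero)))
        (s≤s (injection⇒≤count (g ∘ suc) (λ s t e → Fin.suc-injective (inj _ _ e)) (P ∖ g zero) rest))
  where
  rest : ∀ t → (P ∖ g zero) (g (suc t)) ≡ true
  rest t = ∧-intro (Pg (suc t)) (not-intro (≢⇒==-false λ e → Fin.0≢1+n (inj zero (suc t) e)))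

count-image : ∀ {k} (g : Fin k → Fin n) → (∀ s t → g s ≡ g t → s ≡ t) → count (image g) ≡ k
count-image g inj = ≤-antisym (count-image≤ g) (injection⇒≤count g inj (image g) (λ t → anyᵇ-intro _ t (==-refl (g t))))

∣∣≡count : ∀ (S : Subset n) → ∣ S ∣ ≡ count (lookup S)
∣∣≡count []          = refl
∣∣≡count (true ∷ S)  = cong suc (∣∣≡count S)
∣∣≡count (false ∷ S) = ∣∣≡count S

∣tabulate∣ : ∀ (P : Fin n → Bool) → ∣ tabulate P ∣ ≡ count P
∣tabulate∣ P = trans (∣∣≡count (tabulate P)) (count-cong (lookup∘tabulate P))

∈tabulate : ∀ {P : Fin n → Bool} {i} → P i ≡ true → i ∈ tabulate P
∈tabulate {P = P} {i} Pi = lookup⇒[]= i (tabulate P) (trans (lookup∘tabulate P i) Pi)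

_⊆ᴱ_ : Graph n → Graph n → Set
E ⊆ᴱ F = ∀ i j → E i j ≡ true → F i j ≡ true

Undirected : Graph n → Set
Undirected E = ∀ i j → E i j ≡ E j i

module _ {n : ℕ} {E : Graph n} where

  walk-++ : ∀ {u v w} → Walk E u v → Walk E v w → Walk E u w
  walk-++ here       q = q
  walk-++ (step e p) q = step e (walk-++ p q)

  walk-snoc : ∀ {u v w} → Walk E u v → E v w ≡ true → Walk E u w
  walk-snoc p e = walk-++ p (step e here)

  walk-reverse : Undirected E → ∀ {u v} → Walk E u v → Walk E v u
  walk-reverse E-sym here               = here
  walk-reverse E-sym (step {u} {v} e p) = walk-snoc (walk-reverse E-sym p) (trans (E-sym v u) e)

  walk-mono : ∀ {F : Graph n} → E ⊆ᴱ F → ∀ {u v} → Walk E u v → Walk F u v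
  walk-mono h here       = here
  walk-mono h (step e p) = step (h _ _ e) (walk-mono h p)

  Closed : (Fin n → Bool) → Set
  Closed R = ∀ v w → R v ≡ true → E v w ≡ true → R w ≡ true

  closed-walk : ∀ {R} → Closed R → ∀ {u w} → R u ≡ true → Walk E u w → R w ≡ true
  closed-walk c Ru here       = Ru
  closed-walk c Ru (step e p) = closed-walk c (c _ _ Ru e) p

  grow : (Fin n → Bool) → Fin n → Bool
  grow R w = R w ∨ anyᵇ (λ v → R v ∧ E v w)

  grow-⊇ : ∀ R w → R w ≡ true → grow R w ≡ true
  grow-⊇ R w = ∨-introˡ

  grow-edge : ∀ R v w → R v ≡ true → E v w ≡ true → grow R w ≡ true
  grow-edge R v w Rv e = ∨-introʳ {R w} (anyᵇ-intro (λ v → R v ∧ E v w) v (∧-intro Rv e))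

  grow-closed : ∀ R → Closed R → ∀ w → grow R w ≡ true → R w ≡ true
  grow-closed R c w g with ∨-elim {R w} g
  ... | inj₁ Rw = Rw
  ... | inj₂ a  = let v , RvEvw = anyᵇ-elim _ a ; Rv , e = ∧-elim RvEvw in c v w Rv e

  closed-grow : ∀ R → Closed R → Closed (grow R)
  closed-grow R c v w g e = grow-⊇ R w (c v w (grow-closed R c v g) e)

  grows-or-closed : ∀ R → count R < count (grow R) ⊎ Closed R
  grows-or-closed R with Fin.all? (λ w → grow R w ≟ᵇ R w)
  ... | yes fixed = inj₂ λ v w Rv e → trans (sym (fixed w)) (grow-edge R v w Rv e)
  ... | no ¬fixed with Fin.¬∀⟶∃¬ n _ (λ w → grow R w ≟ᵇ R w) ¬fixed
  ... | w , changed with true-or-false (R w)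
  ...   | inj₁ Rw = ⊥-elim (changed (trans (grow-⊇ R w Rw) (sym Rw)))
  ...   | inj₂ Rw = inj₁ (sum-mono-< (λ v → 𝟙-mono (grow-⊇ R v)) w
                                   (subst₂ (λ a b → 𝟙 a < 𝟙 b) (sym Rw) (sym grown) ≤-refl))
    where
    grown : grow R w ≡ true
    grown = ≢false⇒true λ g → changed (trans g (sym Rw))

  ball : Fin n → ℕ → Fin n → Bool
  ball u zero    = _== u
  ball u (suc m) = grow (ball u m)

  ball-centre : ∀ u m → ball u m u ≡ true
  ball-centre u zero    = ==-refl u
  ball-centre u (suc m) = grow-⊇ _ u (ball-centre u m)

  ball-sound : ∀ u m w → ball u m w ≡ true → Walk E u w
  ball-sound u zero    w b rewrite ==⇒≡ b = here
  ball-sound u (suc m) w b with ∨-elim {ball u m w} b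
  ... | inj₁ b′ = ball-sound u m w b′
  ... | inj₂ a  = let v , bE = anyᵇ-elim _ a ; bv , e = ∧-elim bE in walk-snoc (ball-sound u m v bv) e

  ball-grows-or-closed : ∀ u m → m ≤ count (ball u m) ⊎ Closed (ball u m)
  ball-grows-or-closed u zero = inj₁ z≤n
  ball-grows-or-closed u (suc m) with grows-or-closed (ball u m) | ball-grows-or-closed u m
  ... | inj₂ c  | _       = inj₂ (closed-grow _ c)
  ... | inj₁ _  | inj₂ c  = inj₂ (closed-grow _ c)
  ... | inj₁ lt | inj₁ le = inj₁ (≤-trans (s≤s le) lt)

  ball-closed : ∀ u → Closed (ball u (suc n))
  ball-closed u with ball-grows-or-closed u (suc n)
  ... | inj₂ c  = c
  ... | inj₁ le = ⊥-elim (<⇒≱ le (count≤n _))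

  reachable : Fin n → Fin n → Bool
  reachable u = ball u (suc n)

  reachable-sound : ∀ {u w} → reachable u w ≡ true → Walk E u w
  reachable-sound = ball-sound _ (suc n) _

  reachable-complete : ∀ {u w} → Walk E u w → reachable u w ≡ true
  reachable-complete {u} = closed-walk (ball-closed u) (ball-centre u (suc n))

sum-allFin : ∀ (f : Fin n → ℕ) → sumᴸ (L.map f (L.allFin n)) ≡ sum f
sum-allFin {n} f = trans (cong sumᴸ (L.map-tabulate id f)) (go f)
  where
  go : ∀ {m} (f : Fin m → ℕ) → sumᴸ (L.tabulate f) ≡ sum f
  go {zero}  f = refl
  go {suc m} f = cong (f zero +_) (go (f ∘ suc))

module _ {n : ℕ} where

  below : Fin n → Fin n → Bool
  below i j = toℕ i <ᵇ toℕ j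

  edgeCount-sum : ∀ (E : Graph n) → edgeCount E ≡ sum (λ i → sum (λ j → 𝟙 (below i j ∧ E i j)))
  edgeCount-sum E = trans (sum-allFin (λ i → sumᴸ (L.map (row i) (L.allFin n))))
                          (sum-cong-≗ λ i → sum-allFin (row i))
    where
    row : Fin n → Fin n → ℕ
    row i j = 𝟙 (below i j ∧ E i j)

  below-∧-mono : ∀ {E F : Graph n} → E ⊆ᴱ F → ∀ i j → 𝟙 (below i j ∧ E i j) ≤ 𝟙 (below i j ∧ F i j)
  below-∧-mono E⊆F i j = 𝟙-mono λ b → let l , e = ∧-elim b in ∧-intro l (E⊆F i j e)

  edgeCount-mono : ∀ {E F : Graph n} → E ⊆ᴱ F → edgeCount E ≤ edgeCount F
  edgeCount-mono {E} {F} E⊆F = begin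
    edgeCount E                                       ≡⟨ edgeCount-sum E ⟩
    sum (λ i → sum (λ j → 𝟙 (below i j ∧ E i j)))     ≤⟨ sum-mono (λ i → sum-mono (below-∧-mono E⊆F i)) ⟩
    sum (λ i → sum (λ j → 𝟙 (below i j ∧ F i j)))     ≡⟨ edgeCount-sum F ⟨
    edgeCount F                                       ∎
    where open ≤-Reasoning

  edgeCount-<-at : ∀ {E F : Graph n} → E ⊆ᴱ F → ∀ p q → below p q ≡ true → E p q ≡ false → F p q ≡ true →
                   edgeCount E < edgeCount F
  edgeCount-<-at {E} {F} E⊆F p q l Epq Fpq = begin-strict
    edgeCount E                                       ≡⟨ edgeCount-sum E ⟩
    sum (λ i → sum (λ j → 𝟙 (below i j ∧ E i j)))     <⟨ sum-mono-< (λ i → sum-mono (below-∧-mono E⊆F i)) p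
                                                           (sum-mono-< (below-∧-mono E⊆F p) q gap) ⟩
    sum (λ i → sum (λ j → 𝟙 (below i j ∧ F i j)))     ≡⟨ edgeCount-sum F ⟨
    edgeCount F                                       ∎
    where
    open ≤-Reasoning
    gap : 𝟙 (below p q ∧ E p q) < 𝟙 (below p q ∧ F p q)
    gap rewrite l | Epq | Fpq = ≤-refl

  edgeCount-mono-< : ∀ {E F : Graph n} → E ⊆ᴱ F → Undirected E → Undirected F →
                     ∀ p q → p ≢ q → E p q ≡ false → F p q ≡ true → edgeCount E < edgeCount F
  edgeCount-mono-< {E} {F} E⊆F symE symF p q p≢q Epq Fpq with Fin.<-cmp p q
  ... | tri≈ _ p≡q _ = ⊥-elim (p≢q p≡q)
  ... | tri< p<q _ _ = edgeCount-<-at E⊆F p q (<⇒<ᵇ≡true p<q) Epq Fpq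
  ... | tri> _ _ q<p = edgeCount-<-at E⊆F q p (<⇒<ᵇ≡true q<p) (trans (symE q p) Epq) (trans (symF q p) Fpq)

  edgeCount-pos : ∀ {F : Graph n} → Undirected F → ∀ p q → p ≢ q → F p q ≡ true → 0 < edgeCount F
  edgeCount-pos symF p q p≢q Fpq =
    ≤-trans (s≤s z≤n) (edgeCount-mono-< {E = λ _ _ → false} (λ _ _ ()) (λ _ _ → refl) symF p q p≢q refl Fpq)

module _ {n : ℕ} where
  open import Data.List.Membership.DecPropositional (Fin._≟_ {n}) using (_∈?_)

  data Last (v : Fin n) : List (Fin n) → Set where
    last-one  : Last v (v ∷ [])
    last-cons : ∀ {x xs} → Last v xs → Last v (x ∷ xs)

  record SimplePath (E : Graph n) (u v : Fin n) : Set where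
    field
      inner  : List (Fin n)
      chain  : Chain E (u ∷ inner)
      unique : Unique (u ∷ inner)
      last   : Last v (u ∷ inner)

  private
    chain-suffix : ∀ {E : Graph n} pre {u post} → Chain E (pre ++ u ∷ post) → Chain E (u ∷ post)
    chain-suffix []           c                    = c
    chain-suffix (_ ∷ [])     (cons _ _ _ _ c)     = c
    chain-suffix (_ ∷ y ∷ pre) (cons _ _ _ _ c)    = chain-suffix (y ∷ pre) c

    unique-suffix : ∀ pre {xs : List (Fin n)} → Unique (pre ++ xs) → Unique xs
    unique-suffix []        u       = u
    unique-suffix (_ ∷ pre) (_ ∷ u) = unique-suffix pre u

    last-suffix : ∀ pre {u post v} → Last v (pre ++ u ∷ post) → Last v (u ∷ post)
    last-suffix []            l             = l
    last-suffix (_ ∷ [])      (last-cons l) = l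
    last-suffix (_ ∷ y ∷ pre) (last-cons l) = last-suffix (y ∷ pre) l

  walk⇒simplePath : ∀ {E : Graph n} {u v} → Walk E u v → SimplePath E u v
  walk⇒simplePath {u = u} here = record { inner = [] ; chain = one u ; unique = All.[] ∷ [] ; last = last-one }
  walk⇒simplePath {E} {u} {v} (step {v = u′} e w) with walk⇒simplePath w
  ... | record { inner = ws ; chain = ch ; unique = un ; last = la } with u ∈? (u′ ∷ ws)
  ... | no u∉ = record
          { inner  = u′ ∷ ws
          ; chain  = cons u u′ ws e ch
          ; unique = ¬Any⇒All¬ _ u∉ ∷ un
          ; last   = last-cons la }
  ... | yes u∈ with ∈-∃++ u∈
  ...   | pre , post , eq = record
          { inner  = post
          ; chain  = chain-suffix pre (subst (Chain E) eq ch)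
          ; unique = unique-suffix pre (subst Unique eq un)
          ; last   = last-suffix pre (subst (Last v) eq la) }

  chain-snoc : ∀ {E : Graph n} {L q p} → Chain E L → Last q L → E q p ≡ true → Chain E (L ++ p ∷ [])
  chain-snoc (one v)           last-one      e = cons v _ [] e (one _)
  chain-snoc (cons u v vs e₁ c) (last-cons l) e = cons u v (vs ++ _ ∷ []) e₁ (chain-snoc c l e)

  chain-mono : ∀ {E F : Graph n} → E ⊆ᴱ F → ∀ {L} → Chain E L → Chain F L
  chain-mono h (one v)          = one v
  chain-mono h (cons u v vs e c) = cons u v vs (h u v e) (chain-mono h c)

-- Trees: the two sides of an edge, and Steiner distance

greatest : (P : ℕ → Set) → (∀ e → Dec (P e)) → ∀ B {e₀} → P e₀ → e₀ ≤ B →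
           ∃ λ e → P e × (∀ e′ → e′ ≤ B → P e′ → e′ ≤ e)
greatest P P? zero    Pe₀ e₀≤0 rewrite n≤0⇒n≡0 e₀≤0 = 0 , Pe₀ , λ _ e′≤0 _ → e′≤0
greatest P P? (suc B) Pe₀ e₀≤B with P? (suc B)
... | yes PB = suc B , PB , λ _ e′≤B _ → e′≤B
... | no ¬PB with greatest P P? B Pe₀ (≤-pred (≤∧≢⇒< e₀≤B λ { refl → ¬PB Pe₀ }))
...   | e , Pe , max =
  e , Pe , λ e′ e′≤B Pe′ → max e′ (≤-pred (≤∧≢⇒< e′≤B λ { refl → ¬PB Pe′ })) Pe′

module Tree {n : ℕ} (T : Graph n) (tree : IsTree T) where

  T-sym : Undirected T
  T-sym = proj₁ (proj₁ tree)

  T-irrefl : ∀ i → T i i ≡ false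
  T-irrefl = proj₂ (proj₁ tree)

  T-connected : Connected T
  T-connected = proj₁ (proj₂ tree)

  T-acyclic : Acyclic T
  T-acyclic = proj₂ (proj₂ tree)

  T⇒≢ : ∀ {p q} → T p q ≡ true → p ≢ q
  T⇒≢ Tpq refl = true≢false Tpq (T-irrefl _)

  isEdge : Fin n → Fin n → Graph n
  isEdge p q i j = (i == p ∧ j == q) ∨ (i == q ∧ j == p)

  cut : Fin n → Fin n → Graph n
  cut p q i j = T i j ∧ not (isEdge p q i j)

  cut⊆T : ∀ p q → cut p q ⊆ᴱ T
  cut⊆T p q i j = proj₁ ∘ ∧-elim

  cut-sym : ∀ p q → Undirected (cut p q)
  cut-sym p q i j = cong₂ (λ t e → t ∧ not e) (T-sym i j) (reverse (i == p) (j == q) (i == q) (j == p))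
    where
    reverse : ∀ a b c d → (a ∧ b) ∨ (c ∧ d) ≡ (d ∧ c) ∨ (b ∧ a)
    reverse a b c d = trans (∨-comm (a ∧ b) (c ∧ d)) (cong₂ _∨_ (∧-comm c d) (∧-comm a b))

  cut-swap : ∀ p q i j → cut p q i j ≡ cut q p i j
  cut-swap p q i j = cong (λ e → T i j ∧ not e) (∨-comm (i == p ∧ j == q) (i == q ∧ j == p))

  cut-removes : ∀ p q → cut p q p q ≡ false
  cut-removes p q rewrite ==-refl p | ==-refl q = ∧-zeroʳ (T p q)

  cut-intro : ∀ {p q i j} → T i j ≡ true → ¬ (i ≡ p × j ≡ q) → ¬ (i ≡ q × j ≡ p) → cut p q i j ≡ true
  cut-intro {p} {q} {i} {j} Tij ¬pq ¬qp with true-or-false (isEdge p q i j)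
  ... | inj₂ ¬e rewrite Tij | ¬e = refl
  ... | inj₁ e with ∨-elim {i == p ∧ j == q} e
  ...   | inj₁ a = let x , y = ∧-elim a in ⊥-elim (¬pq (==⇒≡ x , ==⇒≡ y))
  ...   | inj₂ b = let x , y = ∧-elim b in ⊥-elim (¬qp (==⇒≡ x , ==⇒≡ y))

  cut-elim : ∀ {p q i j} → T i j ≡ true → cut p q i j ≡ false → (i ≡ p × j ≡ q) ⊎ (i ≡ q × j ≡ p)
  cut-elim {p} {q} {i} {j} Tij ¬c with i Fin.≟ p ×-dec j Fin.≟ q | i Fin.≟ q ×-dec j Fin.≟ p
  ... | yes pq | _      = inj₁ pq
  ... | no _   | yes qp = inj₂ qp
  ... | no ¬pq | no ¬qp = ⊥-elim (true≢false (cut-intro Tij ¬pq ¬qp) ¬c)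

  onSide : Fin n → Fin n → Fin n → Bool
  onSide p q v = reachable {E = cut p q} v p

  onSide-self : ∀ p q → onSide p q p ≡ true
  onSide-self p q = reachable-complete {E = cut p q} here

  onSide-forward : ∀ {p q a b} → cut p q a b ≡ true → onSide p q a ≡ true → onSide p q b ≡ true
  onSide-forward {p} {q} {a} {b} e s =
    reachable-complete {E = cut p q} (step (trans (cut-sym p q b a) e) (reachable-sound {E = cut p q} s))

  onSide-backward : ∀ {p q a b} → cut p q a b ≡ true → onSide p q b ≡ true → onSide p q a ≡ true
  onSide-backward {p} {q} e s = reachable-complete {E = cut p q} (step e (reachable-sound {E = cut p q} s))

  module _ {p q : Fin n} (Tpq : T p q ≡ true) where

    no-bypass : Walk (cut p q) p q → ⊥
    no-bypass W with walk⇒simplePath W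
    ... | record { inner = [] ; last = last-one } = T⇒≢ Tpq refl
    ... | record { inner = _ ∷ [] ; chain = cons _ _ _ e _ ; last = last-cons last-one } = true≢false e (cut-removes p q)
    ... | record { inner = w₁ ∷ w₂ ∷ ws ; chain = ch ; unique = un ; last = la } =
      T-acyclic p (w₁ ∷ w₂ ∷ ws) (s≤s (s≤s z≤n)) un (chain-snoc (chain-mono (cut⊆T p q) ch) la (trans (T-sym q p) Tpq))

    sides-disjoint : ∀ v → onSide p q v ≡ true → onSide q p v ≡ true → ⊥
    sides-disjoint v a b = no-bypass (walk-++ (walk-reverse (cut-sym p q) (reachable-sound {E = cut p q} a))
                                              (walk-mono (λ i j → subst (_≡ true) (cut-swap q p i j))
                                                         (reachable-sound {E = cut q p} b)))

    sides-cover : ∀ v → onSide p q v ≡ true ⊎ onSide q p v ≡ true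
    sides-cover v = cover (T-connected v p)
      where
      cover : ∀ {w} → Walk T w p → onSide p q w ≡ true ⊎ onSide q p w ≡ true
      cover here = inj₁ (onSide-self p q)
      cover (step {w} {w′} e rest) with true-or-false (cut p q w w′) | cover rest
      ... | inj₁ c | inj₁ s = inj₁ (onSide-backward c s)
      ... | inj₁ c | inj₂ s = inj₂ (onSide-backward (trans (cut-swap q p w w′) c) s)
      ... | inj₂ ¬c | _ with cut-elim e ¬c
      ...   | inj₁ (refl , refl) = inj₁ (onSide-self p q)
      ...   | inj₂ (refl , refl) = inj₂ (onSide-self q p)

    other-side : ∀ v → onSide p q v ≡ false → onSide q p v ≡ true
    other-side v ¬s with sides-cover v
    ... | inj₁ s = ⊥-elim (true≢false s ¬s)
    ... | inj₂ s = s

    walk-crosses : ∀ {E : Graph n} → E ⊆ᴱ T → ∀ {a b} → Walk E a b →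
                   onSide p q a ≡ true → onSide q p b ≡ true → E p q ≡ true ⊎ E q p ≡ true
    walk-crosses E⊆T {a} here sa sb = ⊥-elim (sides-disjoint a sa sb)
    walk-crosses E⊆T (step {a} {a′} e rest) sa sb with true-or-false (cut p q a a′)
    ... | inj₁ c  = walk-crosses E⊆T rest (onSide-forward c sa) sb
    ... | inj₂ ¬c with cut-elim (E⊆T _ _ e) ¬c
    ...   | inj₁ (refl , refl) = inj₁ e
    ...   | inj₂ (refl , refl) = ⊥-elim (sides-disjoint q sa (onSide-self q p))

  meets : (Fin n → Bool) → Fin n → Fin n → Bool
  meets X p q = anyᵇ (λ v → X v ∧ onSide p q v)

  separating : (Fin n → Bool) → Graph n
  separating X p q = T p q ∧ (meets X p q ∧ meets X q p)

  separating-sym : ∀ X → Undirected (separating X)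
  separating-sym X p q = cong₂ _∧_ (T-sym p q) (∧-comm (meets X p q) (meets X q p))

  separating⊆T : ∀ X → separating X ⊆ᴱ T
  separating⊆T X p q = proj₁ ∘ ∧-elim

  separating-intro : ∀ {X p q a b} → T p q ≡ true → X a ≡ true → X b ≡ true →
                     onSide p q a ≡ true → onSide q p b ≡ true → separating X p q ≡ true
  separating-intro {X} {p} {q} {a} {b} Tpq Xa Xb sa sb =
    ∧-intro Tpq (∧-intro (anyᵇ-intro (λ v → X v ∧ onSide p q v) a (∧-intro Xa sa))
                         (anyᵇ-intro (λ v → X v ∧ onSide q p v) b (∧-intro Xb sb)))

  separating-elim : ∀ {X p q} → separating X p q ≡ true →
                    T p q ≡ true × (∃ λ a → X a ≡ true × onSide p q a ≡ true)
                                 × (∃ λ b → X b ≡ true × onSide q p b ≡ true)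
  separating-elim s with ∧-elim s
  ... | Tpq , m with ∧-elim m
  ... | ma , mb with anyᵇ-elim _ ma | anyᵇ-elim _ mb
  ... | a , Xsa | b , Xsb = Tpq , (a , ∧-elim Xsa) , (b , ∧-elim Xsb)

  separating-mono : ∀ {X Y} → (∀ v → X v ≡ true → Y v ≡ true) → separating X ⊆ᴱ separating Y
  separating-mono X⊆Y p q s with separating-elim s
  ... | Tpq , (a , Xa , sa) , (b , Xb , sb) = separating-intro Tpq (X⊆Y a Xa) (X⊆Y b Xb) sa sb

  open ConnSubgraph

  separating⊆subgraph : ∀ {S} (H : ConnSubgraph T S) → separating (lookup S) ⊆ᴱ E H
  separating⊆subgraph {S} H p q s with separating-elim s
  ... | Tpq , (a , Sa , sa) , (b , Sb , sb)
      with walk-crosses Tpq (E⊆G H) (conn H a b (S⊆Vs H (lookup⇒[]= a S Sa)) (S⊆Vs H (lookup⇒[]= b S Sb))) sa sb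
  ...   | inj₁ Epq = Epq
  ...   | inj₂ Eqp = trans (Esym H p q) Eqp

  module Restriction {S : Subset n} (H : ConnSubgraph T S) {p q : Fin n} (Tpq : T p q ≡ true) (Epq : E H p q ≡ true)
                     (S-onSide : ∀ s → lookup S s ≡ true → onSide p q s ≡ true) where

    sideEdges : Graph n
    sideEdges i j = E H i j ∧ (onSide p q i ∧ onSide p q j)

    reroute : ∀ {w v} → Walk (E H) w v → onSide p q v ≡ true →
              (onSide p q w ≡ true → Walk sideEdges w v) × (onSide q p w ≡ true → Walk sideEdges p v)
    reroute {v = v} here sv = (λ _ → here) , (λ s′ → ⊥-elim (sides-disjoint Tpq v sv s′))
    reroute (step {w} {w′} e rest) sv with reroute rest sv | true-or-false (cut p q w w′)
    ... | here-p , here-q | inj₁ c =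
          (λ sw → let sw′ = onSide-forward c sw in step (∧-intro e (∧-intro sw sw′)) (here-p sw′))
        , (λ sw → here-q (onSide-forward (trans (cut-swap q p w w′) c) sw))
    ... | here-p , here-q | inj₂ ¬c with cut-elim (E⊆G H _ _ e) ¬c
    ...   | inj₁ (refl , refl) = (λ _ → here-q (onSide-self q p))
                                 , (λ s′ → ⊥-elim (sides-disjoint Tpq p (onSide-self p q) s′))
    ...   | inj₂ (refl , refl) = (λ s → ⊥-elim (sides-disjoint Tpq q s (onSide-self q p)))
                                 , (λ _ → here-p (onSide-self p q))

    sideVertices : Fin n → Bool
    sideVertices i = lookup (Vs H) i ∧ onSide p q i

    restriction : ConnSubgraph T S
    restriction = record
      { Vs    = tabulate sideVertices
      ; E     = sideEdges
      ; E⊆G   = λ i j → E⊆G H i j ∘ proj₁ ∘ ∧-elim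
      ; Esym  = λ i j → cong₂ _∧_ (Esym H i j) (∧-comm (onSide p q i) (onSide p q j))
      ; Eends = λ i j e → let Eij , si , _ = ∧-elim′ e in
                  lookup⇒[]= i _ (trans (lookup∘tabulate sideVertices i) (∧-intro ([]=⇒lookup (Eends H i j Eij)) si))
      ; S⊆Vs  = λ {s} s∈S → lookup⇒[]= s _ (trans (lookup∘tabulate sideVertices s)
                  (∧-intro ([]=⇒lookup (S⊆Vs H s∈S)) (S-onSide s ([]=⇒lookup s∈S))))
      ; conn  = λ u v u∈ v∈ → let Vu , su = ∧-elim (trans (sym (lookup∘tabulate sideVertices u)) ([]=⇒lookup u∈))
                                  Vv , sv = ∧-elim (trans (sym (lookup∘tabulate sideVertices v)) ([]=⇒lookup v∈))
                              in proj₁ (reroute (conn H u v (lookup⇒[]= u _ Vu) (lookup⇒[]= v _ Vv)) sv) su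
      }
      where
      ∧-elim′ : ∀ {a b c} → a ∧ (b ∧ c) ≡ true → a ≡ true × b ≡ true × c ≡ true
      ∧-elim′ e = let a , bc = ∧-elim e in a , ∧-elim bc

    restriction-smaller : edgeCount sideEdges < edgeCount (E H)
    restriction-smaller = edgeCount-mono-< (λ i j → proj₁ ∘ ∧-elim) (ConnSubgraph.Esym restriction) (Esym H)
                            p q (T⇒≢ Tpq) removed Epq
      where
      q-off : onSide p q q ≡ false
      q-off = ¬true⇒false λ s → sides-disjoint Tpq q s (onSide-self q p)
      removed : sideEdges p q ≡ false
      removed rewrite q-off = trans (cong (E H p q ∧_) (∧-zeroʳ (onSide p q p))) (∧-zeroʳ (E H p q))

  meets-false : ∀ {X p q s} → meets X p q ≡ false → X s ≡ true → onSide p q s ≡ false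
  meets-false {X} {p} {q} {s} ¬m Xs =
    ¬true⇒false λ ss → true≢false (anyᵇ-intro (λ v → X v ∧ onSide p q v) s (∧-intro Xs ss)) ¬m

  -- A non-separating edge of H has all of S on one side; restricting H to that side deletes the edge,
  -- so iterating leaves only separating edges.
  trim : ∀ {S} fuel (H : ConnSubgraph T S) → edgeCount (E H) < fuel →
         Σ (ConnSubgraph T S) λ H′ → E H′ ⊆ᴱ separating (lookup S)
  trim zero H ()
  trim {S} (suc fuel) H lt
    with Fin.any? (λ p → Fin.any? λ q → (E H p q ≟ᵇ true) ×-dec (separating (lookup S) p q ≟ᵇ false))
  ... | no none = H , λ p q Epq → ≢false⇒true λ ¬s → none (p , q , Epq , ¬s)
  ... | yes (p , q , Epq , ¬s) with E⊆G H p q Epq | true-or-false (meets (lookup S) q p) | true-or-false (meets (lookup S) p q)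
  ...   | Tpq | inj₁ mq | inj₁ mp = ⊥-elim (true≢false (∧-intro Tpq (∧-intro mp mq)) ¬s)
  ...   | Tpq | inj₂ ¬mq | _ =
          trim fuel (Restriction.restriction H Tpq Epq onP) (≤-trans (Restriction.restriction-smaller H Tpq Epq onP) (≤-pred lt))
    where
    onP : ∀ s → lookup S s ≡ true → onSide p q s ≡ true
    onP s Ss = other-side (trans (T-sym q p) Tpq) s (meets-false ¬mq Ss)
  ...   | Tpq | inj₁ _ | inj₂ ¬mp =
          trim fuel (Restriction.restriction H Tqp Eqp onQ) (≤-trans (Restriction.restriction-smaller H Tqp Eqp onQ) (≤-pred lt))
    where
    Tqp : T q p ≡ true
    Tqp = trans (T-sym q p) Tpq
    Eqp : E H q p ≡ true
    Eqp = trans (Esym H q p) Epq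
    onQ : ∀ s → lookup S s ≡ true → onSide q p s ≡ true
    onQ s Ss = other-side Tpq s (meets-false ¬mp Ss)

  whole : ∀ S → ConnSubgraph T S
  whole S = record { Vs = ⊤ ; E = T ; E⊆G = λ _ _ e → e ; Esym = T-sym ; Eends = λ _ _ _ → ∈⊤
                   ; S⊆Vs = λ _ → ∈⊤ ; conn = λ u v _ _ → T-connected u v }

  steinerDist : Subset n → ℕ
  steinerDist S = edgeCount (separating (lookup S))

  steinerDist-spec : ∀ S → IsSteinerDist T S (steinerDist S)
  steinerDist-spec S with trim (suc (edgeCount T)) (whole S) ≤-refl
  ... | H , trimmed = (H , ≤-antisym (edgeCount-mono trimmed) (edgeCount-mono (separating⊆subgraph H)))
                    , edgeCount-mono ∘ separating⊆subgraph

  steinerDist-unique : ∀ S d → IsSteinerDist T S d → d ≡ steinerDist S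
  steinerDist-unique S d ((H , |H|≡d) , minimal) = ≤-antisym
    (subst (d ≤_) (proj₂ (proj₁ (steinerDist-spec S))) (minimal (proj₁ (proj₁ (steinerDist-spec S)))))
    (subst (steinerDist S ≤_) |H|≡d (edgeCount-mono (separating⊆subgraph H)))

  steinerDist≤ : ∀ S → steinerDist S ≤ edgeCount T
  steinerDist≤ S = edgeCount-mono (separating⊆T (lookup S))

  eccentricity-exists : ∀ k (S′ : Subset n) → ∣ S′ ∣ ≤ k → k ≤ n → ∃ λ e → IsSteinerEcc T k S′ e
  eccentricity-exists k S′ S′≤k k≤n
    with extend-to (lookup S′) (subst (_≤ k) (∣∣≡count S′) S′≤k) k≤n
  ... | Y , S′⊆Y , |Y|≡k
    with greatest Candidate candidate? (edgeCount T) first (steinerDist≤ (tabulate Y))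
    where
    Candidate : ℕ → Set
    Candidate e = ∃ λ S → S′ ⊆ S × ∣ S ∣ ≡ k × steinerDist S ≡ e
    candidate? : ∀ e → Dec (Candidate e)
    candidate? e = anySubset? λ S → (S′ ⊆? S) ×-dec ((∣ S ∣ ℕ.≟ k) ×-dec (steinerDist S ℕ.≟ e))
    first : Candidate (steinerDist (tabulate Y))
    first = tabulate Y , (λ {v} v∈S′ → ∈tabulate (S′⊆Y v ([]=⇒lookup v∈S′)))
          , trans (∣tabulate∣ Y) |Y|≡k , refl
  ... | e , (S , S′⊆S , |S|≡k , dS) , max =
        e , (S , S′⊆S , |S|≡k , subst (IsSteinerDist T S) dS (steinerDist-spec S))
          , λ R d S′⊆R |R|≡k dR → subst (_≤ e) (sym (steinerDist-unique R d dR))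
                                     (max (steinerDist R) (steinerDist≤ R) (R , S′⊆R , |R|≡k , refl))

  separating-far : ∀ {X p q} → separating X p q ≡ true → ∀ u →
                   ∃ λ f → X f ≡ true × (∀ {Z} → Z f ≡ true → Z u ≡ true → separating Z p q ≡ true)
  separating-far sX u with separating-elim sX
  ... | Tpq , (a , Xa , sa) , (b , Xb , sb) with sides-cover Tpq u
  ...   | inj₁ su = b , Xb , λ Zb Zu → separating-intro Tpq Zu Zb su sb
  ...   | inj₂ su = a , Xa , λ Za Zu → separating-intro Tpq Za Zu sa su

  steinerDist-pos : ∀ S {u w} → lookup S u ≡ true → lookup S w ≡ true → u ≢ w → 1 ≤ steinerDist S
  steinerDist-pos S {u} {w} Su Sw u≢w = spanned (steinerDist-spec S)
    where
    nonempty : ∀ (H : ConnSubgraph T S) {a b} → Walk (E H) a b → a ≢ b → 1 ≤ edgeCount (E H)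
    nonempty H here                a≢a = ⊥-elim (a≢a refl)
    nonempty H (step {a} {a′} e _) _   = edgeCount-pos (Esym H) a a′ (T⇒≢ (E⊆G H a a′ e)) e
    spanned : IsSteinerDist T S (steinerDist S) → 1 ≤ steinerDist S
    spanned ((H , |H|) , _) =
      subst (1 ≤_) |H| (nonempty H (conn H u w (S⊆Vs H (lookup⇒[]= u S Su)) (S⊆Vs H (lookup⇒[]= w S Sw))) u≢w)

-- The inequality

module DoubleCounting {n : ℕ} (T : Graph n) (tree : IsTree T) (j : ℕ)
                      (S : Fin n → Bool) (|S| : count S ≡ 2 + j) (S′ : Fin n → Bool) (|S′| : count S′ ≡ 2)
                      (S′-spread : 1 ≤ edgeCount (Tree.separating T tree S′))
                      (R : ℕ) (radius : ∀ X → (∀ v → S′ v ≡ true → X v ≡ true) → count X ≤ 2 + j →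
                                        edgeCount (Tree.separating T tree X) ≤ R) where
  open Tree T tree

  Pair : Fin n → Fin n → Bool
  Pair s t = S s ∧ (S ∖ s) t

  X : Fin n → Fin n → Fin n → Bool
  X s t v = S′ v ∨ (S ∖ s ∖ t) v

  |X|≤k : ∀ s t → Pair s t ≡ true → count (X s t) ≤ 2 + j
  |X|≤k s t st = begin
    count (X s t)                  ≤⟨ count-∨ S′ (S ∖ s ∖ t) ⟩
    count S′ + count (S ∖ s ∖ t)   ≡⟨ cong₂ _+_ |S′| (suc-injective (suc-injective (begin-equality
      suc (suc (count (S ∖ s ∖ t))) ≡⟨ cong suc (count-remove-∈ (S ∖ s) t (proj₂ (∧-elim {S s} st))) ⟨
      suc (count (S ∖ s))           ≡⟨ count-remove-∈ S s (proj₁ (∧-elim {S s} st)) ⟨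
      count S                       ≡⟨ |S| ⟩
      2 + j                         ∎))) ⟩
    2 + j                          ∎
    where open ≤-Reasoning

  pairs : sum₂ (λ s t → 𝟙 (Pair s t)) ≡ (2 + j) * (1 + j)
  pairs = count-ordered-pairs S (1 + j) |S|

  u : Fin n
  u = proj₁ (count-pos S′ (subst (0 <_) (sym |S′|) (s≤s z≤n)))

  S′u : S′ u ≡ true
  S′u = proj₂ (count-pos S′ (subst (0 <_) (sym |S′|) (s≤s z≤n)))

  separated-pairs : Fin n → Fin n → ℕ
  separated-pairs p q = sum₂ (λ s t → 𝟙 (Pair s t ∧ separating (X s t) p q))

  A B : ℕ
  A = (1 + j) * j
  B = 2 * (1 + j)

  all-pairs : ∀ p q → separating S′ p q ≡ true →
              A * 𝟙 (separating S p q) + B * 1 ≤ separated-pairs p q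
  all-pairs p q s′ = begin
    A * 𝟙 (separating S p q) + B * 1
      ≤⟨ +-monoˡ-≤ (B * 1) (*-monoʳ-≤ A (𝟙≤1 _)) ⟩
    A * 1 + B * 1
      ≡⟨ arithmetic j ⟩
    (2 + j) * (1 + j)
      ≡⟨ pairs ⟨
    sum₂ (λ s t → 𝟙 (Pair s t))
      ≡⟨ sum-cong-≗ (λ s → sum-cong-≗ λ t → cong 𝟙 (everywhere s t)) ⟨
    separated-pairs p q ∎
    where
    open ≤-Reasoning
    arithmetic : ∀ j → (1 + j) * j * 1 + 2 * (1 + j) * 1 ≡ (2 + j) * (1 + j)
    arithmetic = solve-∀
    everywhere : ∀ s t → Pair s t ∧ separating (X s t) p q ≡ Pair s t
    everywhere s t = trans (cong (Pair s t ∧_) (separating-mono (λ v → ∨-introˡ) p q s′)) (∧-identityʳ (Pair s t))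

  pairs-avoiding : ∀ p q → separating S p q ≡ true → A ≤ separated-pairs p q
  pairs-avoiding p q sS with separating-far sS u
  ... | f , Sf , sep = begin
    A
      ≡⟨ count-ordered-pairs (S ∖ f) j (trans (suc-injective (trans (sym (count-remove-∈ S f Sf)) |S|)) refl) ⟨
    sum₂ (λ s t → 𝟙 ((S ∖ f) s ∧ (S ∖ f ∖ s) t))
      ≤⟨ sum₂-mono (λ s t → 𝟙-mono (avoids s t)) ⟩
    separated-pairs p q ∎
    where
    open ≤-Reasoning
    avoids : ∀ s t → (S ∖ f) s ∧ (S ∖ f ∖ s) t ≡ true → Pair s t ∧ separating (X s t) p q ≡ true
    avoids s t e with ∧-elim {(S ∖ f) s} e
    ... | Sfs , Sfst with ∖-elim {P = S} Sfs | ∖-elim {P = S ∖ f} Sfst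
    ... | Ss , f≢s | Sft , s≢t with ∖-elim {P = S} Sft
    ... | St , f≢t = ∧-intro (∧-intro Ss (∖-intro {P = S} St s≢t))
                             (sep {X s t} (∨-introʳ {S′ f} (∖-intro {P = S ∖ s} (∖-intro {P = S} Sf (f≢s ∘ sym))
                                                                                           (f≢t ∘ sym)))
                                          (∨-introˡ S′u))

  weight : Bool → Bool → ℕ
  weight a b = A * 𝟙 a + B * 𝟙 b

  edge-bound : ∀ p q → weight (separating S p q) (separating S′ p q) ≤ separated-pairs p q
  edge-bound p q with true-or-false (separating S′ p q) | true-or-false (separating S p q)
  ... | inj₁ s′  | _ =
        subst (λ b → weight (separating S p q) b ≤ separated-pairs p q) (sym s′) (all-pairs p q s′)
  ... | inj₂ ¬s′ | inj₂ ¬sS =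
        ≤-trans (≤-reflexive (trans (cong₂ weight ¬sS ¬s′) (cong₂ _+_ (*-zeroʳ A) (*-zeroʳ B)))) z≤n
  ... | inj₂ ¬s′ | inj₁ sS =
        ≤-trans (≤-reflexive (trans (cong₂ weight sS ¬s′)
                                    (trans (cong₂ _+_ (*-identityʳ A) (*-zeroʳ B)) (+-identityʳ A))))
                (pairs-avoiding p q sS)

  oriented-edge-bound : ∀ p q → weight (below p q ∧ separating S p q) (below p q ∧ separating S′ p q)
                                ≤ sum₂ (λ s t → 𝟙 (Pair s t ∧ (below p q ∧ separating (X s t) p q)))
  oriented-edge-bound p q with below p q
  ... | true  = edge-bound p q
  ... | false = ≤-trans (≤-reflexive (cong₂ _+_ (*-zeroʳ A) (*-zeroʳ B))) z≤n

  pair-bound : ∀ s t → sum₂ (λ p q → 𝟙 (Pair s t ∧ (below p q ∧ separating (X s t) p q))) ≤ 𝟙 (Pair s t) * R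
  pair-bound s t = begin
    sum₂ (λ p q → 𝟙 (Pair s t ∧ (below p q ∧ separating (X s t) p q)))
      ≡⟨ sum-cong-≗ (λ p → sum-cong-≗ λ q → 𝟙-∧ (Pair s t) (below p q ∧ separating (X s t) p q)) ⟩
    sum₂ (λ p q → 𝟙 (Pair s t) * 𝟙 (below p q ∧ separating (X s t) p q))
      ≡⟨ sum₂-scale (𝟙 (Pair s t)) (λ p q → 𝟙 (below p q ∧ separating (X s t) p q)) ⟩
    𝟙 (Pair s t) * sum₂ (λ p q → 𝟙 (below p q ∧ separating (X s t) p q))
      ≡⟨ cong (𝟙 (Pair s t) *_) (edgeCount-sum (separating (X s t))) ⟨
    𝟙 (Pair s t) * edgeCount (separating (X s t))
      ≤⟨ 𝟙*-mono (Pair s t) (λ st → radius (X s t) (λ v → ∨-introˡ) (|X|≤k s t st)) ⟩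
    𝟙 (Pair s t) * R ∎
    where open ≤-Reasoning

  inequality : j * edgeCount (separating S) + 2 ≤ (2 + j) * R
  inequality = *-cancelˡ-≤ (1 + j) (begin
    (1 + j) * (j * d + 2)
      ≡⟨ expand j d ⟩
    A * d + B * 1
      ≤⟨ +-monoʳ-≤ (A * d) (*-monoʳ-≤ B S′-spread) ⟩
    A * d + B * d′
      ≡⟨ cong₂ (λ x y → A * x + B * y) (edgeCount-sum (separating S)) (edgeCount-sum (separating S′)) ⟩
    A * sum₂ (λ p q → 𝟙 (below p q ∧ separating S p q)) + B * sum₂ (λ p q → 𝟙 (below p q ∧ separating S′ p q))
      ≡⟨ sum₂-linear A B (λ p q → 𝟙 (below p q ∧ separating S p q))
                         (λ p q → 𝟙 (below p q ∧ separating S′ p q)) ⟨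
    sum₂ (λ p q → weight (below p q ∧ separating S p q) (below p q ∧ separating S′ p q))
      ≤⟨ sum₂-mono oriented-edge-bound ⟩
    sum₂ (λ p q → sum₂ (λ s t → 𝟙 (Pair s t ∧ (below p q ∧ separating (X s t) p q))))
      ≡⟨ sum₂-comm (λ p q s t → 𝟙 (Pair s t ∧ (below p q ∧ separating (X s t) p q))) ⟩
    sum₂ (λ s t → sum₂ (λ p q → 𝟙 (Pair s t ∧ (below p q ∧ separating (X s t) p q))))
      ≤⟨ sum₂-mono pair-bound ⟩
    sum₂ (λ s t → 𝟙 (Pair s t) * R)
      ≡⟨ sum-cong-≗ (λ s → sum-cong-≗ λ t → *-comm (𝟙 (Pair s t)) R) ⟩
    sum₂ (λ s t → R * 𝟙 (Pair s t))
      ≡⟨ sum₂-scale R (λ s t → 𝟙 (Pair s t)) ⟩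
    R * sum₂ (λ s t → 𝟙 (Pair s t))
      ≡⟨ cong (R *_) pairs ⟩
    R * ((2 + j) * (1 + j))
      ≡⟨ regroup j R ⟩
    (1 + j) * ((2 + j) * R) ∎)
    where
    open ≤-Reasoning
    d d′ : ℕ
    d  = edgeCount (separating S)
    d′ = edgeCount (separating S′)
    expand : ∀ j d → (1 + j) * (j * d + 2) ≡ (1 + j) * j * d + 2 * (1 + j) * 1
    expand = solve-∀
    regroup : ∀ j R → R * ((2 + j) * (1 + j)) ≡ (1 + j) * ((2 + j) * R)
    regroup = solve-∀

steiner-inequality : ∀ {n} (T : Graph n) → IsTree T → ∀ j {D R} → 2 + j ≤ n →
                     IsSteinerDiam T (2 + j) D → IsSteinerRad T (2 + j) 2 R → j * D + 2 ≤ (2 + j) * R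
steiner-inequality T tree j {R = R} k≤n ((_ , (S , _ , |S| , dS) , _) , _) ((S′ , |S′| , _ , S′-ecc) , _) =
  subst (λ D → j * D + 2 ≤ (2 + j) * R) (sym (steinerDist-unique S _ dS))
        (DoubleCounting.inequality T tree j (lookup S) (trans (sym (∣∣≡count S)) |S|) (lookup S′) |S′|ᵇ spread R radius)
  where
  open Tree T tree
  |S′|ᵇ : count (lookup S′) ≡ 2
  |S′|ᵇ = trans (sym (∣∣≡count S′)) |S′|
  spread : 1 ≤ steinerDist S′
  spread = let u , w , u≢w , S′u , S′w = two-distinct (lookup S′) (≤-reflexive (sym |S′|ᵇ))
           in steinerDist-pos S′ S′u S′w u≢w
  radius : ∀ X → (∀ v → lookup S′ v ≡ true → X v ≡ true) → count X ≤ 2 + j → edgeCount (separating X) ≤ R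
  radius X S′⊆X |X|≤k with extend-to X |X|≤k k≤n
  ... | Y , X⊆Y , |Y| =
    ≤-trans (edgeCount-mono (separating-mono λ v Xv → trans (lookup∘tabulate Y v) (X⊆Y v Xv)))
            (S′-ecc (tabulate Y) _ (λ {v} v∈S′ → ∈tabulate (X⊆Y v (S′⊆X v ([]=⇒lookup v∈S′))))
                    (trans (∣tabulate∣ Y) |Y|) (steinerDist-spec (tabulate Y)))

-- Rooted trees

module Rooted {n : ℕ} (T : Graph n) (tree : IsTree T) (r : Fin n) (par : Fin n → Fin n) (rank : Fin n → ℕ)
              (rank-par : ∀ i → i ≢ r → rank (par i) < rank i)
              (T-char : ∀ i j → T i j ≡ (not (i == r) ∧ j == par i) ∨ (not (j == r) ∧ i == par j)) where
  open Tree T tree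

  T-par : ∀ {c} → c ≢ r → T c (par c) ≡ true
  T-par {c} c≢r = trans (T-char c (par c)) (∨-introˡ (∧-intro (not-intro (≢⇒==-false c≢r)) (==-refl (par c))))

  par≢ : ∀ {c} → c ≢ r → par c ≢ c
  par≢ {c} c≢r e = <-irrefl (cong rank e) (rank-par c c≢r)

  InSubtree : Fin n → Fin n → Bool
  InSubtree c = onSide c (par c)

  parent-edge-kept : ∀ {c y} → c ≢ r → y ≢ r → y ≢ c → cut c (par c) y (par y) ≡ true
  parent-edge-kept {c} {y} c≢r y≢r y≢c = cut-intro (T-par y≢r) (y≢c ∘ proj₁) λ { (refl , py≡c) →
    <-irrefl refl (<-trans (subst (λ z → rank z < rank (par c)) py≡c (rank-par (par c) y≢r)) (rank-par c c≢r)) }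

  InSubtree-par : ∀ {c y} → c ≢ r → y ≢ r → y ≢ c → InSubtree c y ≡ InSubtree c (par y)
  InSubtree-par {c} {y} c≢r y≢r y≢c = ⇔⇒≡ (onSide-forward kept) (onSide-backward kept)
    where
    kept : cut c (par c) y (par y) ≡ true
    kept = parent-edge-kept c≢r y≢r y≢c

  InSubtree-up : ∀ {c y} → c ≢ r → y ≢ r → InSubtree c (par y) ≡ true → InSubtree c y ≡ true
  InSubtree-up {c} {y} c≢r y≢r s with y Fin.≟ c
  ... | yes refl = onSide-self y (par y)
  ... | no y≢c   = trans (InSubtree-par c≢r y≢r y≢c) s

  root-outside : ∀ {c} → c ≢ r → InSubtree c r ≡ false
  root-outside {c} c≢r = ¬true⇒false λ s → sides-disjoint (T-par c≢r) r s
    (reachable-complete {E = cut (par c) c} (walk-mono (λ i j → subst (_≡ true) (cut-swap c (par c) i j))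
      (walk-reverse (cut-sym c (par c)) (climb (suc (rank (par c))) (par c) ≤-refl ≤-refl))))
    where
    climb : ∀ fuel v → rank v < fuel → rank v ≤ rank (par c) → Walk (cut c (par c)) v r
    climb zero       v ()
    climb (suc fuel) v v<fuel v≤pc with v Fin.≟ r
    ... | yes refl = here
    ... | no v≢r   = step (parent-edge-kept c≢r v≢r λ { refl → <-irrefl refl (≤-<-trans v≤pc (rank-par c c≢r)) })
                          (climb fuel (par v) (≤-trans (rank-par v v≢r) (≤-pred v<fuel))
                                              (≤-trans (<⇒≤ (rank-par v v≢r)) v≤pc))

  InSubtree-rank : ∀ {c y} → c ≢ r → InSubtree c y ≡ true → rank c ≤ rank y
  InSubtree-rank {c} {y} c≢r = go (suc (rank y)) y ≤-refl
    where
    go : ∀ fuel y → rank y < fuel → InSubtree c y ≡ true → rank c ≤ rank y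
    go zero       y ()
    go (suc fuel) y y<fuel s with y Fin.≟ c | y Fin.≟ r
    ... | yes refl | _        = ≤-refl
    ... | no _     | yes refl = ⊥-elim (true≢false s (root-outside c≢r))
    ... | no y≢c   | no y≢r   = <⇒≤ (≤-<-trans (go fuel (par y) (≤-trans (rank-par y y≢r) (≤-pred y<fuel))
                                                  (trans (sym (InSubtree-par c≢r y≢r y≢c)) s)) (rank-par y y≢r))

  private
    IsChild : Fin n → Fin n → Bool
    IsChild i j = not (i == r) ∧ j == par i

    not-mutual : ∀ i j → IsChild i j ∧ IsChild j i ≡ false
    not-mutual i j = ¬true⇒false λ e →
      let ij , ji = ∧-elim e ; i≠r , j≡pi = ∧-elim ij ; j≠r , i≡pj = ∧-elim ji in
      <-asym (subst (λ z → rank z < rank i) (sym (==⇒≡ j≡pi)) (rank-par i (not==⇒≢ i≠r)))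
             (subst (λ z → rank z < rank j) (sym (==⇒≡ i≡pj)) (rank-par j (not==⇒≢ j≠r)))

    split : ∀ b f x y → (f ≡ true → x ∨ y ≡ true) → x ∧ y ≡ false →
            𝟙 (b ∧ f) ≡ 𝟙 (b ∧ (f ∧ x)) + 𝟙 (b ∧ (f ∧ y))
    split false f     x     y     _ _  = refl
    split true  false x     y     _ _  = refl
    split true  true  true  false _ _  = refl
    split true  true  false true  _ _  = refl
    split true  true  false false h _  = ⊥-elim (true≢false (h refl) refl)
    split true  true  true  true  _ ()

    ∧-zero-∧ : ∀ x y → x ∧ (y ∧ false) ≡ false
    ∧-zero-∧ x y = trans (cong (x ∧_) (∧-zeroʳ y)) (∧-zeroʳ x)

    delta : ∀ x y z e → 𝟙 (x ∧ (y ∧ (z ∧ e))) ≡ (if e then 𝟙 (x ∧ (y ∧ z)) else 0)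
    delta x y z true  = cong (λ w → 𝟙 (x ∧ (y ∧ w))) (∧-identityʳ z)
    delta x y z false = cong 𝟙 (trans (cong (λ w → x ∧ (y ∧ w)) (∧-zeroʳ z)) (∧-zero-∧ x y))

    orient : ∀ b b′ f → b ≡ not b′ → 𝟙 (b ∧ f) + 𝟙 (b′ ∧ f) ≡ 𝟙 f
    orient true  false f _ = +-identityʳ (𝟙 f)
    orient false true  f _ = refl

    orient′ : ∀ b b′ f f′ nr → f′ ≡ f → (nr ≡ true → b ≡ not b′) →
              𝟙 (b ∧ (f ∧ nr)) + 𝟙 (b′ ∧ (f′ ∧ nr)) ≡ 𝟙 (nr ∧ f)
    orient′ b b′ f _ false refl _ = cong₂ _+_ (cong 𝟙 (∧-zero-∧ b f)) (cong 𝟙 (∧-zero-∧ b′ f))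
    orient′ b b′ f _ true  refl h =
      trans (cong₂ _+_ (cong (λ w → 𝟙 (b ∧ w)) (∧-identityʳ f)) (cong (λ w → 𝟙 (b′ ∧ w)) (∧-identityʳ f)))
            (orient b b′ f (h refl))

    below-antisym : ∀ {c d : Fin n} → c ≢ d → below c d ≡ not (below d c)
    below-antisym {c} {d} c≢d with Fin.<-cmp c d
    ... | tri< c<d _ _ = trans (<⇒<ᵇ≡true c<d) (cong not (sym (¬true⇒false (<-asym c<d ∘ <ᵇ≡true⇒<))))
    ... | tri≈ _ c≡d _ = ⊥-elim (c≢d c≡d)
    ... | tri> _ _ d<c = trans (¬true⇒false (<-asym d<c ∘ <ᵇ≡true⇒<)) (cong not (sym (<⇒<ᵇ≡true d<c)))

  edgeCount-by-child : ∀ (F : Graph n) → Undirected F → F ⊆ᴱ T →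
                       edgeCount F ≡ sum (λ c → 𝟙 (not (c == r) ∧ F c (par c)))
  edgeCount-by-child F F-sym F⊆T = begin
    edgeCount F
      ≡⟨ edgeCount-sum F ⟩
    sum₂ (λ i j → 𝟙 (below i j ∧ F i j))
      ≡⟨ sum-cong-≗ (λ i → sum-cong-≗ λ j → split (below i j) (F i j) (IsChild i j) (IsChild j i)
                                                 (λ e → trans (sym (T-char i j)) (F⊆T i j e)) (not-mutual i j)) ⟩
    sum₂ (λ i j → Fwd i j + Bwd i j)
      ≡⟨ trans (sum-cong-≗ λ i → ∑-distrib-+ (Fwd i) (Bwd i))
               (∑-distrib-+ (λ i → sum (Fwd i)) (λ i → sum (Bwd i))) ⟩
    sum₂ Fwd + sum₂ Bwd
      ≡⟨ cong₂ _+_ upward (trans (∑-comm Bwd) downward) ⟩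
    sum Up + sum Down
      ≡⟨ ∑-distrib-+ Up Down ⟨
    sum (λ c → Up c + Down c)
      ≡⟨ sum-cong-≗ one-orientation ⟩
    sum (λ c → 𝟙 (not (c == r) ∧ F c (par c))) ∎
    where
    open ≡-Reasoning
    Fwd Bwd : Fin n → Fin n → ℕ
    Fwd i j = 𝟙 (below i j ∧ (F i j ∧ IsChild i j))
    Bwd i j = 𝟙 (below i j ∧ (F i j ∧ IsChild j i))
    Up Down : Fin n → ℕ
    Up   c = 𝟙 (below c (par c) ∧ (F c (par c) ∧ not (c == r)))
    Down c = 𝟙 (below (par c) c ∧ (F (par c) c ∧ not (c == r)))
    upward : sum₂ Fwd ≡ sum Up
    upward = sum-cong-≗ λ i → trans (sum-cong-≗ λ j → delta (below i j) (F i j) (not (i == r)) (j == par i))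
                                    (sum-delta (par i) (λ j → 𝟙 (below i j ∧ (F i j ∧ not (i == r)))))
    downward : sum₂ (λ j i → Bwd i j) ≡ sum Down
    downward = sum-cong-≗ λ j → trans (sum-cong-≗ λ i → delta (below i j) (F i j) (not (j == r)) (i == par j))
                                      (sum-delta (par j) (λ i → 𝟙 (below i j ∧ (F i j ∧ not (j == r)))))
    one-orientation : ∀ c → Up c + Down c ≡ 𝟙 (not (c == r) ∧ F c (par c))
    one-orientation c =
      orient′ _ _ _ _ (not (c == r)) (F-sym (par c) c) (λ c≠r → below-antisym (par≢ (not==⇒≢ c≠r) ∘ sym))

-- The trees P₂(a,b;x)

module Labels (a x′ : ℕ) where

  x : ℕ
  x = suc x′

  parent : ℕ → ℕ
  parent zero                = 0
  parent (suc zero)          = 0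
  parent (suc (suc m))       = if ⌊ x ∣? m ⌋ then (if m <ᵇ a * x then 0 else 1) else suc m

  parent< : ∀ l → l ≢ 0 → parent l < l
  parent< zero          l≢0 = ⊥-elim (l≢0 refl)
  parent< (suc zero)    _   = s≤s z≤n
  parent< (suc (suc m)) _ with ⌊ x ∣? m ⌋ | m <ᵇ a * x
  ... | true  | true  = s≤s z≤n
  ... | true  | false = s≤s (s≤s z≤n)
  ... | false | _     = ≤-refl

  parent≤ : ∀ l → parent l ≤ l
  parent≤ zero    = z≤n
  parent≤ (suc l) = <⇒≤ (parent< (suc l) λ ())

  IsParent : ℕ → ℕ → Bool
  IsParent v u = not (v ≡ᵇ 0) ∧ (u ≡ᵇ parent v)

  IsParent-parentIs : ∀ v u → IsParent v u ≡ ((v ≡ᵇ 1) ∧ (u ≡ᵇ 0)) ∨ parentIs a x v u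
  IsParent-parentIs zero          u = refl
  IsParent-parentIs (suc zero)    u = sym (∨-identityʳ (u ≡ᵇ 0))
  IsParent-parentIs (suc (suc m)) u with ⌊ x ∣? m ⌋ | m <ᵇ a * x
  ... | true  | true  = refl
  ... | true  | false = refl
  ... | false | _     = refl

  P2≡IsParent : ∀ v u → ((v ≡ᵇ 0) ∧ (u ≡ᵇ 1)) ∨ ((v ≡ᵇ 1) ∧ (u ≡ᵇ 0))
                          ∨ parentIs a x v u ∨ parentIs a x u v
                        ≡ IsParent v u ∨ IsParent u v
  P2≡IsParent v u rewrite IsParent-parentIs v u | IsParent-parentIs u v | ∧-comm (u ≡ᵇ 1) (v ≡ᵇ 0) =
    regroup ((v ≡ᵇ 0) ∧ (u ≡ᵇ 1)) ((v ≡ᵇ 1) ∧ (u ≡ᵇ 0)) (parentIs a x v u) (parentIs a x u v)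
    where
    regroup : ∀ A B C D → A ∨ B ∨ C ∨ D ≡ (B ∨ C) ∨ (A ∨ D)
    regroup true  _     _     _ = sym (∨-zeroʳ _)
    regroup false true  _     _ = refl
    regroup false false true  _ = refl
    regroup false false false _ = refl

  lab : ℕ → ℕ → ℕ
  lab j p = 2 + (j * x + p)

  off-base : ∀ j p → suc p < x → ¬ x ∣ j * x + suc p
  off-base j p sp<x x∣ = <⇒≱ sp<x (∣⇒≤ (∣m+n∣m⇒∣n x∣ (n∣m*n j)))

  parent-lab-suc : ∀ j p → suc p < x → parent (lab j (suc p)) ≡ lab j p
  parent-lab-suc j p sp<x rewrite ⌊⌋-false (x ∣? (j * x + suc p)) (off-base j p sp<x) =
    cong suc (+-suc (j * x) p)

  parent-lab-zero : ∀ j → parent (lab j 0) ≡ (if j <ᵇ a then 0 else 1)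
  parent-lab-zero j rewrite +-identityʳ (j * x) | ⌊⌋-true (x ∣? (j * x)) (n∣m*n j) = cong (if_then 0 else 1) (scale j a)
    where
    scale : ∀ j a → (j * x <ᵇ a * x) ≡ (j <ᵇ a)
    scale j a with j <? a
    ... | yes j<a = trans (<⇒<ᵇ≡true (*-monoˡ-< x j<a)) (sym (<⇒<ᵇ≡true j<a))
    ... | no j≮a  = trans (¬true⇒false (≤⇒≯ (*-monoˡ-≤ x (≮⇒≥ j≮a)) ∘ <ᵇ≡true⇒<))
                          (sym (¬true⇒false (j≮a ∘ <ᵇ≡true⇒<)))

  parent-lab-zero≤1 : ∀ j → parent (lab j 0) ≤ 1
  parent-lab-zero≤1 j rewrite parent-lab-zero j with j <ᵇ a
  ... | true  = z≤n
  ... | false = ≤-refl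

  lab-quotient : ∀ j p → p < x → (j * x + p) / x ≡ j
  lab-quotient j p p<x =
    trans (+-distrib-/-∣ˡ p (n∣m*n j)) (trans (cong₂ _+_ (m*n/n≡m j x) (m<n⇒m/n≡0 p<x)) (+-identityʳ j))

  lab-injective : ∀ {j j′ p p′} → p < x → p′ < x → lab j p ≡ lab j′ p′ → j ≡ j′ × p ≡ p′
  lab-injective {j} {j′} {p} {p′} p<x p′<x e =
    j≡j′ , +-cancelˡ-≡ (j * x) p p′ (trans m≡ (cong (λ i → i * x + p′) (sym j≡j′)))
    where
    m≡ : j * x + p ≡ j′ * x + p′
    m≡ = suc-injective (suc-injective e)
    j≡j′ : j ≡ j′
    j≡j′ = trans (sym (lab-quotient j p p<x)) (trans (cong (_/ x) m≡) (lab-quotient j′ p′ p′<x))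

  lab-surjective : ∀ l → 2 ≤ l → ∃ λ j → ∃ λ p → p < x × l ≡ lab j p
  lab-surjective (suc zero)    (s≤s ())
  lab-surjective (suc (suc m)) _       = m / x , m % x , m%n<n m x , cong (2 +_) (trans (m≡m%n+[m/n]*n m x) (+-comm (m % x) _))

module DoubleSpider (a′ b′ x′ : ℕ) {n : ℕ} (T : Graph n) (tree : IsTree T)
                    (iso : Iso T (P2 (suc a′) (suc b′) (suc x′))) where

  a b : ℕ
  a = suc a′
  b = suc b′

  open Labels a x′ public

  N : ℕ
  N = 2 + (a + b) * x

  private
    π : Fin n ↔ Fin N
    π = proj₁ iso

  label : Fin n → ℕ
  label i = toℕ (Inverse.to π i)

  label<N : ∀ i → label i < N
  label<N i = Fin.toℕ<n (Inverse.to π i)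

  vertex : ∀ l → l < N → Fin n
  vertex l l<N = Inverse.from π (fromℕ< l<N)

  label-vertex : ∀ l l<N → label (vertex l l<N) ≡ l
  label-vertex l l<N = trans (cong toℕ (Inverse.strictlyInverseˡ π (fromℕ< l<N))) (Fin.toℕ-fromℕ< l<N)

  label-injective : ∀ {i j} → label i ≡ label j → i ≡ j
  label-injective {i} {j} e = trans (sym (Inverse.strictlyInverseʳ π i))
                                    (trans (cong (Inverse.from π) (Fin.toℕ-injective e)) (Inverse.strictlyInverseʳ π j))

  label⇒vertex : ∀ {i} l l<N → label i ≡ l → i ≡ vertex l l<N
  label⇒vertex l l<N e = label-injective (trans e (sym (label-vertex l l<N)))

  ==-vertex : ∀ i l l<N → (i == vertex l l<N) ≡ (label i ≡ᵇ l)
  ==-vertex i l l<N = ⇔⇒≡ (λ e → ≡⇒≡ᵇ≡true (trans (cong label (==⇒≡ e)) (label-vertex l l<N)))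
                          (λ e → ≡⇒== (label⇒vertex l l<N (≡ᵇ≡true⇒≡ e)))

  0<N : 0 < N
  0<N = s≤s z≤n

  1<N : 1 < N
  1<N = s≤s (s≤s z≤n)

  parent<N : ∀ i → parent (label i) < N
  parent<N i = ≤-<-trans (parent≤ (label i)) (label<N i)

  r v₁ : Fin n
  r  = vertex 0 0<N
  v₁ = vertex 1 1<N

  par : Fin n → Fin n
  par i = vertex (parent (label i)) (parent<N i)

  label-par : ∀ i → label (par i) ≡ parent (label i)
  label-par i = label-vertex (parent (label i)) (parent<N i)

  label≢0⇒≢r : ∀ {i} → label i ≢ 0 → i ≢ r
  label≢0⇒≢r l≢0 refl = l≢0 (label-vertex 0 0<N)

  rank-par : ∀ i → i ≢ r → label (par i) < label i
  rank-par i i≢r = subst (_< label i) (sym (label-par i))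
                         (parent< (label i) (i≢r ∘ label⇒vertex 0 0<N))

  T-char : ∀ i j → T i j ≡ (not (i == r) ∧ j == par i) ∨ (not (j == r) ∧ i == par j)
  T-char i j = trans (proj₂ iso i j) (trans (P2≡IsParent (label i) (label j))
    (cong₂ _∨_ (cong₂ (λ u w → not u ∧ w) (sym (==-vertex i 0 0<N)) (sym (==-vertex j _ (parent<N i))))
               (cong₂ (λ u w → not u ∧ w) (sym (==-vertex j 0 0<N)) (sym (==-vertex i _ (parent<N j))))))

  open Tree T tree public
  open Rooted T tree r par label rank-par T-char public

  2≤⇒≢r : ∀ {i} → 2 ≤ label i → i ≢ r
  2≤⇒≢r 2≤l = label≢0⇒≢r λ l≡0 → <⇒≱ (s≤s z≤n) (subst (2 ≤_) l≡0 2≤l)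

  lab≢r : ∀ {y} j p → label y ≡ lab j p → y ≢ r
  lab≢r j p ly = 2≤⇒≢r (subst (2 ≤_) (sym ly) (s≤s (s≤s z≤n)))

  label-par-lab : ∀ {y} j p → label y ≡ lab j (suc p) → suc p < x → label (par y) ≡ lab j p
  label-par-lab {y} j p ly sp<x = trans (label-par y) (trans (cong parent ly) (parent-lab-suc j p sp<x))

  leg-ancestor : ∀ j p → p < x → ∀ {y c} → label y ≡ lab j p → 2 ≤ label c → InSubtree c y ≡ true →
                 ∃ λ p′ → p′ ≤ p × label c ≡ lab j p′
  leg-ancestor j p p<x {y} {c} ly 2≤c s with y Fin.≟ c
  ... | yes refl = p , ≤-refl , ly
  ... | no y≢c = above p p<x ly (trans (sym (InSubtree-par (2≤⇒≢r 2≤c) (lab≢r j _ ly) y≢c)) s)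
    where
    above : ∀ p → p < x → label y ≡ lab j p → InSubtree c (par y) ≡ true →
            ∃ λ p′ → p′ ≤ p × label c ≡ lab j p′
    above zero    _   ly s = ⊥-elim (<⇒≱ 2≤c (≤-trans (InSubtree-rank (2≤⇒≢r 2≤c) s)
                                (subst (_≤ 1) (sym (trans (label-par y) (cong parent ly))) (parent-lab-zero≤1 j))))
    above (suc p) p<x ly s with leg-ancestor j p (<⇒≤ p<x) (label-par-lab j p ly p<x) 2≤c s
    ... | p′ , p′≤p , lc = p′ , m≤n⇒m≤1+n p′≤p , lc

  leg-descendant : ∀ j p → p < x → ∀ {y c p′} → label y ≡ lab j p → p′ ≤ p → label c ≡ lab j p′ →
                   InSubtree c y ≡ true
  leg-descendant j p p<x {y} {c} {p′} ly p′≤p lc with m≤n⇒m<n∨m≡n p′≤p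
  ... | inj₂ refl = subst (λ z → InSubtree z y ≡ true) (label-injective (trans ly (sym lc))) (onSide-self y (par y))
  ... | inj₁ p′<p = further p p<x ly p′<p
    where
    further : ∀ p → p < x → label y ≡ lab j p → p′ < p → InSubtree c y ≡ true
    further (suc p) p<x ly (s≤s p′≤p) =
      InSubtree-up (lab≢r j _ lc) (lab≢r j _ ly) (leg-descendant j p (<⇒≤ p<x) (label-par-lab j p ly p<x) p′≤p lc)

  v₁≢r : v₁ ≢ r
  v₁≢r = label≢0⇒≢r λ l≡0 → 1+n≢0 (trans (sym (label-vertex 1 1<N)) l≡0)

  lab≢v₁ : ∀ {y} j p → label y ≡ lab j p → y ≢ v₁
  lab≢v₁ j p ly refl = 1+n≢0 (sym (suc-injective (trans (sym (label-vertex 1 1<N)) ly)))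

  InSubtree-v₁ : ∀ j p → p < x → ∀ {y} → label y ≡ lab j p → InSubtree v₁ y ≡ not (j <ᵇ a)
  InSubtree-v₁ j (suc p) p<x {y} ly =
    trans (InSubtree-par v₁≢r (lab≢r j _ ly) (lab≢v₁ j _ ly)) (InSubtree-v₁ j p (<⇒≤ p<x) (label-par-lab j p ly p<x))
  InSubtree-v₁ j zero _ {y} ly =
    trans (InSubtree-par v₁≢r (lab≢r j _ ly) (lab≢v₁ j _ ly)) (base (true-or-false (j <ᵇ a)))
    where
    base-label : label (par y) ≡ (if j <ᵇ a then 0 else 1)
    base-label = trans (label-par y) (trans (cong parent ly) (parent-lab-zero j))
    base : (j <ᵇ a) ≡ true ⊎ (j <ᵇ a) ≡ false → InSubtree v₁ (par y) ≡ not (j <ᵇ a)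
    base (inj₁ t) = trans (cong (InSubtree v₁) (label⇒vertex 0 0<N (trans base-label (cong (λ d → if d then 0 else 1) t))))
                          (trans (root-outside v₁≢r) (cong not (sym t)))
    base (inj₂ f) = trans (cong (InSubtree v₁) (label⇒vertex 1 1<N (trans base-label (cong (λ d → if d then 0 else 1) f))))
                          (trans (onSide-self v₁ (par v₁)) (cong not (sym f)))

  lab<N : ∀ {j p} → j < a + b → p < x → lab j p < N
  lab<N {j} {p} j<a+b p<x = s≤s (s≤s (begin-strict
    j * x + p  <⟨ +-monoʳ-< (j * x) p<x ⟩
    j * x + x  ≡⟨ +-comm (j * x) x ⟩
    suc j * x  ≤⟨ *-monoˡ-≤ x j<a+b ⟩
    (a + b) * x ∎))
    where open ≤-Reasoning

  lab<N⇒leg : ∀ {j p} → lab j p < N → j < a + b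
  lab<N⇒leg {j} {p} (s≤s (s≤s lt)) = *-cancelʳ-< x j (a + b) (≤-<-trans (m≤m+n (j * x) p) lt)

  Leg : Fin n → Bool
  Leg c = not (c == r) ∧ not (c == v₁)

  Leg⇒2≤ : ∀ {c} → Leg c ≡ true → 2 ≤ label c
  Leg⇒2≤ {c} e with ∧-elim e | label c in lc
  ... | c≠r , _   | zero        = ⊥-elim (not==⇒≢ c≠r (label⇒vertex 0 0<N lc))
  ... | _   , c≠v₁ | suc zero    = ⊥-elim (not==⇒≢ c≠v₁ (label⇒vertex 1 1<N lc))
  ... | _   , _   | suc (suc _) = s≤s (s≤s z≤n)

  leg-ancestors≤x : ∀ y → 2 ≤ label y → count (λ c → Leg c ∧ InSubtree c y) ≤ x
  leg-ancestors≤x y 2≤y with lab-surjective (label y) 2≤y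
  ... | j , p , p<x , ly = ≤-trans (count-mono in-image) (count-image≤ leg-vertex)
    where
    j<a+b : j < a + b
    j<a+b = lab<N⇒leg (subst (_< N) ly (label<N y))
    leg-vertex : Fin x → Fin n
    leg-vertex t = vertex (lab j (toℕ t)) (lab<N j<a+b (Fin.toℕ<n t))
    in-image : ∀ c → Leg c ∧ InSubtree c y ≡ true → image leg-vertex c ≡ true
    in-image c e with ∧-elim e
    ... | leg , s with leg-ancestor j p p<x ly (Leg⇒2≤ leg) s
    ...   | p′ , p′≤p , lc = anyᵇ-intro (λ t → c == leg-vertex t) (fromℕ< p′<x)
                               (≡⇒== (label⇒vertex _ (lab<N j<a+b (Fin.toℕ<n (fromℕ< p′<x)))
                                                      (trans lc (cong (lab j) (sym (Fin.toℕ-fromℕ< p′<x))))))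
      where
      p′<x : p′ < x
      p′<x = ≤-<-trans p′≤p p<x

  r≢v₁ : r ≢ v₁
  r≢v₁ = v₁≢r ∘ sym

  Leg-intro : ∀ {c} → c ≢ r → c ≢ v₁ → Leg c ≡ true
  Leg-intro c≢r c≢v₁ = ∧-intro (not-intro (≢⇒==-false c≢r)) (not-intro (≢⇒==-false c≢v₁))

  LegAbove : (Fin n → Bool) → Fin n → Fin n → Bool
  LegAbove Y c y = (Y ∖ r ∖ v₁) y ∧ (Leg c ∧ InSubtree c y)

  parent-edge-witness : ∀ (Y : Fin n → Bool) c →
                        𝟙 (not (c == r) ∧ separating Y c (par c)) ≤ 𝟙 (c == v₁) + sum (λ y → 𝟙 (LegAbove Y c y))
  parent-edge-witness Y c = 𝟙≤ λ t → let c≠r , sep = ∧-elim t in witness (not==⇒≢ c≠r) sep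
    where
    witness : c ≢ r → separating Y c (par c) ≡ true → 1 ≤ 𝟙 (c == v₁) + sum (λ y → 𝟙 (LegAbove Y c y))
    witness c≢r sep with true-or-false (c == v₁) | separating-elim sep
    ... | inj₁ c=v₁ | _ = ≤-trans (≤-reflexive (cong 𝟙 (sym c=v₁))) (m≤m+n _ _)
    ... | inj₂ c≠v₁ | _ , (y , Yy , sy) , _ =
          ≤-trans (≤-reflexive (cong 𝟙 (sym above))) (≤-trans (term≤sum (λ y → 𝟙 (LegAbove Y c y)) y) (m≤n+m _ _))
      where
      c≢v₁ : c ≢ v₁
      c≢v₁ refl = true≢false (==-refl v₁) c≠v₁
      y≢r : y ≢ r
      y≢r refl = true≢false sy (root-outside c≢r)
      y≢v₁ : y ≢ v₁
      y≢v₁ refl = <⇒≱ (Leg⇒2≤ (Leg-intro c≢r c≢v₁))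
                      (subst (label c ≤_) (label-vertex 1 1<N) (InSubtree-rank c≢r sy))
      above : LegAbove Y c y ≡ true
      above = ∧-intro (∖-intro {P = Y ∖ r} (∖-intro {P = Y} Yy (y≢r ∘ sym)) (y≢v₁ ∘ sym))
                      (∧-intro (Leg-intro c≢r c≢v₁) sy)

  through-centre : ∀ (Y : Fin n → Bool) m → Y r ≡ true → Y v₁ ≡ true → count Y ≡ 2 + m →
                   edgeCount (separating Y) ≤ 1 + x * m
  through-centre Y m Yr Yv₁ |Y| = begin
    edgeCount (separating Y)
      ≡⟨ edgeCount-by-child (separating Y) (separating-sym Y) (separating⊆T Y) ⟩
    sum (λ c → 𝟙 (not (c == r) ∧ separating Y c (par c)))
      ≤⟨ sum-mono (parent-edge-witness Y) ⟩
    sum (λ c → 𝟙 (c == v₁) + sum (λ y → 𝟙 (LegAbove Y c y)))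
      ≡⟨ ∑-distrib-+ (λ c → 𝟙 (c == v₁)) _ ⟩
    count (_== v₁) + sum₂ (λ c y → 𝟙 (LegAbove Y c y))
      ≡⟨ cong₂ _+_ (count-single v₁) (∑-comm (λ c y → 𝟙 (LegAbove Y c y))) ⟩
    1 + sum (λ y → count (λ c → Y′ y ∧ A c y))
      ≡⟨ cong (1 +_) (sum-cong-≗ λ y → count-∧ˡ (Y′ y) (λ c → A c y)) ⟩
    1 + sum (λ y → 𝟙 (Y′ y) * count (λ c → A c y))
      ≤⟨ +-monoʳ-≤ 1 (sum-mono λ y → 𝟙*-mono (Y′ y) (ancestors y)) ⟩
    1 + sum (λ y → 𝟙 (Y′ y) * x)
      ≡⟨ cong (1 +_) (trans (sum-cong-≗ λ y → *-comm (𝟙 (Y′ y)) x) (sum-scale x (𝟙 ∘ Y′))) ⟩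
    1 + x * count Y′
      ≡⟨ cong (λ c → 1 + x * c) |Y′| ⟩
    1 + x * m ∎
    where
    open ≤-Reasoning
    Y′ : Fin n → Bool
    Y′ = Y ∖ r ∖ v₁
    A : Fin n → Fin n → Bool
    A c y = Leg c ∧ InSubtree c y
    |Y′| : count Y′ ≡ m
    |Y′| = suc-injective (suc-injective (trans (cong suc (sym (count-remove-∈ (Y ∖ r) v₁ (∖-intro {P = Y} Yv₁ r≢v₁))))
                                               (trans (sym (count-remove-∈ Y r Yr)) |Y|)))
    ancestors : ∀ y → Y′ y ≡ true → count (λ c → A c y) ≤ x
    ancestors y Y′y = let Y∖r , v₁≢y = ∖-elim {P = Y ∖ r} Y′y ; _ , r≢y = ∖-elim {P = Y} Y∖r in
                      leg-ancestors≤x y (Leg⇒2≤ (Leg-intro (r≢y ∘ sym) (v₁≢y ∘ sym)))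

  centre : Fin 2 → Fin n
  centre zero       = r
  centre (suc zero) = v₁

  centre-injective : ∀ s t → centre s ≡ centre t → s ≡ t
  centre-injective zero       zero       _ = refl
  centre-injective zero       (suc zero) e = ⊥-elim (r≢v₁ e)
  centre-injective (suc zero) zero       e = ⊥-elim (v₁≢r e)
  centre-injective (suc zero) (suc zero) _ = refl

  |centre| : ∣ tabulate (image centre) ∣ ≡ 2
  |centre| = trans (∣tabulate∣ (image centre)) (count-image centre centre-injective)

  radius-bound : ∀ m {R} → 2 + m ≤ n → IsSteinerRad T (2 + m) 2 R → R ≤ 1 + x * m
  radius-bound m {R} k≤n (_ , minimal) =
    bound (eccentricity-exists (2 + m) (tabulate (image centre)) (≤-trans (≤-reflexive |centre|) (m≤m+n 2 m)) k≤n)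
    where
    bound : (∃ λ e → IsSteinerEcc T (2 + m) (tabulate (image centre)) e) → R ≤ 1 + x * m
    bound (e , ecc@((Y , centre⊆Y , |Y| , dY) , _)) =
      ≤-trans (minimal _ e |centre| ecc)
              (subst (_≤ 1 + x * m) (sym (steinerDist-unique Y e dY))
                     (through-centre (lookup Y) m (in-Y zero) (in-Y (suc zero)) (trans (sym (∣∣≡count Y)) |Y|)))
      where
      in-Y : ∀ t → lookup Y (centre t) ≡ true
      in-Y t = []=⇒lookup (centre⊆Y (∈tabulate (anyᵇ-intro (λ s → centre t == centre s) t (==-refl (centre t)))))

  module LegWindow (m : ℕ) (k≤a+b : 2 + m ≤ a + b) where

    K : ℕ
    K = 2 + m

    -- the K consecutive legs s₀, …, s₀ + K - 1 include legs a′ (attached to r) and a (attached to v₁)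
    s₀ : ℕ
    s₀ = a′ ⊓ (a + b ∸ K)

    s₀≤a′ : s₀ ≤ a′
    s₀≤a′ = m⊓n≤m a′ (a + b ∸ K)

    s₀+K≤a+b : s₀ + K ≤ a + b
    s₀+K≤a+b = ≤-trans (+-monoˡ-≤ K (m⊓n≤n a′ (a + b ∸ K))) (≤-reflexive (m∸n+n≡m k≤a+b))

    a<s₀+K : a < s₀ + K
    a<s₀+K with ≤-total a′ (a + b ∸ K)
    ... | inj₁ a′≤ rewrite m≤n⇒m⊓n≡m a′≤ =
          ≤-trans (s≤s (s≤s (m≤m+n a′ m))) (≤-reflexive (sym (trans (+-suc a′ (suc m)) (cong suc (+-suc a′ m)))))
    ... | inj₂ ≤a′ rewrite m≥n⇒m⊓n≡n ≤a′ | m∸n+n≡m k≤a+b =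
          s≤s (≤-trans (s≤s (m≤m+n a′ b′)) (≤-reflexive (sym (+-suc a′ b′))))

    leg< : ∀ t → t < K → s₀ + t < a + b
    leg< t t<K = ≤-trans (+-monoʳ-< s₀ t<K) s₀+K≤a+b

    leaf : Fin K → Fin n
    leaf t = vertex (lab (s₀ + toℕ t) x′) (lab<N (leg< (toℕ t) (Fin.toℕ<n t)) ≤-refl)

    label-leaf : ∀ t → label (leaf t) ≡ lab (s₀ + toℕ t) x′
    label-leaf t = label-vertex _ (lab<N (leg< (toℕ t) (Fin.toℕ<n t)) ≤-refl)

    leaf-injective : ∀ s t → leaf s ≡ leaf t → s ≡ t
    leaf-injective s t e = Fin.toℕ-injective (+-cancelˡ-≡ s₀ _ _
      (proj₁ (lab-injective ≤-refl ≤-refl (trans (sym (label-leaf s)) (trans (cong label e) (label-leaf t))))))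

    Leaves : Subset n
    Leaves = tabulate (image leaf)

    |Leaves| : ∣ Leaves ∣ ≡ K
    |Leaves| = trans (∣tabulate∣ (image leaf)) (count-image leaf leaf-injective)

    leaf∈ : ∀ t → lookup Leaves (leaf t) ≡ true
    leaf∈ t = trans (lookup∘tabulate (image leaf) (leaf t)) (anyᵇ-intro (λ s → leaf t == leaf s) t (==-refl (leaf t)))

    leaf-on-leg : ∀ j → s₀ ≤ j → j < s₀ + K → ∃ λ t → label (leaf t) ≡ lab j x′
    leaf-on-leg j s₀≤j j<s₀+K =
      fromℕ< t<K , trans (label-leaf (fromℕ< t<K))
                         (trans (cong (λ i → lab (s₀ + i) x′) (Fin.toℕ-fromℕ< t<K)) (cong (λ i → lab i x′) (m+[n∸m]≡n s₀≤j)))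
      where
      t<K : j ∸ s₀ < K
      t<K = +-cancelˡ-< s₀ (j ∸ s₀) K (subst (_< s₀ + K) (sym (m+[n∸m]≡n s₀≤j)) j<s₀+K)

    v₁-separates : separating (lookup Leaves) v₁ (par v₁) ≡ true
    v₁-separates =
      separating-intro (T-par v₁≢r) (leaf∈ tₐ) (leaf∈ tₐ′) under (other-side (T-par v₁≢r) (leaf tₐ′) not-under)
      where
      tₐ tₐ′ : Fin K
      tₐ  = proj₁ (leaf-on-leg a  (m≤n⇒m≤1+n s₀≤a′) a<s₀+K)
      tₐ′ = proj₁ (leaf-on-leg a′ s₀≤a′ (≤-trans (n≤1+n a) a<s₀+K))
      under : InSubtree v₁ (leaf tₐ) ≡ true
      under = trans (InSubtree-v₁ a x′ ≤-refl (proj₂ (leaf-on-leg a (m≤n⇒m≤1+n s₀≤a′) a<s₀+K)))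
                    (not-intro (¬true⇒false (<-irrefl refl ∘ <ᵇ≡true⇒< {a} {a})))
      not-under : InSubtree v₁ (leaf tₐ′) ≡ false
      not-under = trans (InSubtree-v₁ a′ x′ ≤-refl (proj₂ (leaf-on-leg a′ s₀≤a′ (≤-trans (n≤1+n a) a<s₀+K))))
                        (cong not (<⇒<ᵇ≡true {a′} {a} ≤-refl))

    legs<N : ∀ (c : Fin (K * x)) → lab s₀ (toℕ c) < N
    legs<N c = s≤s (s≤s (begin-strict
      s₀ * x + toℕ c   <⟨ +-monoʳ-< (s₀ * x) (Fin.toℕ<n c) ⟩
      s₀ * x + K * x   ≡⟨ *-distribʳ-+ x s₀ K ⟨
      (s₀ + K) * x     ≤⟨ *-monoˡ-≤ x s₀+K≤a+b ⟩
      (a + b) * x      ∎))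
      where open ≤-Reasoning

    legs : Fin (K * x) → Fin n
    legs c = vertex (lab s₀ (toℕ c)) (legs<N c)

    position : Fin (K * x) → Fin K × Fin x
    position = remQuot {K} x

    legs-position : ∀ c → label (legs c) ≡ lab (s₀ + toℕ (proj₁ (position c))) (toℕ (proj₂ (position c)))
    legs-position c = trans (label-vertex _ (legs<N c))
      (cong (2 +_) (trans (cong (s₀ * x +_) c≡) (regroup s₀ x (toℕ (proj₁ (position c))) (toℕ (proj₂ (position c))))))
      where
      c≡ : toℕ c ≡ x * toℕ (proj₁ (position c)) + toℕ (proj₂ (position c))
      c≡ = trans (cong toℕ (sym (Fin.combine-remQuot {K} x c))) (Fin.toℕ-combine (proj₁ (position c)) (proj₂ (position c)))
      regroup : ∀ s x t p → s * x + (x * t + p) ≡ (s + t) * x + p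
      regroup = solve-∀

    other : Fin K → Fin K
    other zero    = suc zero
    other (suc _) = zero

    other≢ : ∀ t → other t ≢ t
    other≢ zero    ()
    other≢ (suc _) ()

    leg-separates : ∀ c → separating (lookup Leaves) (legs c) (par (legs c)) ≡ true
    leg-separates c =
      separating-intro (T-par c≢r) (leaf∈ t) (leaf∈ (other t)) under (other-side (T-par c≢r) (leaf (other t)) not-under)
      where
      t : Fin K
      t = proj₁ (position c)
      p : Fin x
      p = proj₂ (position c)
      c≢r : legs c ≢ r
      c≢r = lab≢r (s₀ + toℕ t) (toℕ p) (legs-position c)
      under : InSubtree (legs c) (leaf t) ≡ true
      under = leg-descendant (s₀ + toℕ t) x′ ≤-refl (label-leaf t) (≤-pred (Fin.toℕ<n p)) (legs-position c)
      not-under : InSubtree (legs c) (leaf (other t)) ≡ false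
      not-under = ¬true⇒false λ s →
        let p′ , p′≤x′ , lc = leg-ancestor (s₀ + toℕ (other t)) x′ ≤-refl (label-leaf (other t))
                                       (subst (2 ≤_) (sym (legs-position c)) (s≤s (s≤s z≤n))) s
        in other≢ t (Fin.toℕ-injective (+-cancelˡ-≡ s₀ _ _ (sym (proj₁ (lab-injective (Fin.toℕ<n p) (s≤s p′≤x′)
                                                                                   (trans (sym (legs-position c)) lc))))))

    separated-child : Fin (suc (K * x)) → Fin n
    separated-child zero    = v₁
    separated-child (suc c) = legs c

    separated-child-injective : ∀ s t → separated-child s ≡ separated-child t → s ≡ t
    separated-child-injective zero    zero    _ = refl
    separated-child-injective zero    (suc c) e = ⊥-elim (lab≢v₁ s₀ (toℕ c) (label-vertex _ (legs<N c)) (sym e))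
    separated-child-injective (suc c) zero    e = ⊥-elim (lab≢v₁ s₀ (toℕ c) (label-vertex _ (legs<N c)) e)
    separated-child-injective (suc c) (suc d) e = cong suc (Fin.toℕ-injective (+-cancelˡ-≡ (s₀ * x) _ _
      (suc-injective (suc-injective (trans (sym (label-vertex _ (legs<N c))) (trans (cong label e) (label-vertex _ (legs<N d))))))))

    Leaves-distance : 1 + K * x ≤ steinerDist Leaves
    Leaves-distance = subst (1 + K * x ≤_) (sym (edgeCount-by-child _ (separating-sym _) (separating⊆T _)))
      (injection⇒≤count separated-child separated-child-injective _ separates)
      where
      separates : ∀ t → let c = separated-child t in not (c == r) ∧ separating (lookup Leaves) c (par c) ≡ true
      separates zero    = ∧-intro (not-intro (≢⇒==-false v₁≢r)) v₁-separates
      separates (suc c) = ∧-intro (not-intro (≢⇒==-false (lab≢r s₀ (toℕ c) (label-vertex _ (legs<N c))))) (leg-separates c)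

    diameter-bound : ∀ {D} → K ≤ n → IsSteinerDiam T K D → 1 + K * x ≤ D
    diameter-bound {D} k≤n (_ , maximal) =
      bound (eccentricity-exists K ⁅ leaf zero ⁆ (≤-trans (≤-reflexive (∣⁅x⁆∣≡1 (leaf zero))) (s≤s z≤n)) k≤n)
      where
      leaf⊆Leaves : ⁅ leaf zero ⁆ ⊆ Leaves
      leaf⊆Leaves v∈ rewrite x∈⁅y⁆⇒x≡y (leaf zero) v∈ = lookup⇒[]= (leaf zero) Leaves (leaf∈ zero)
      bound : (∃ λ e → IsSteinerEcc T K ⁅ leaf zero ⁆ e) → 1 + K * x ≤ D
      bound (e , ecc) = ≤-trans Leaves-distance
        (≤-trans (proj₂ ecc Leaves (steinerDist Leaves) leaf⊆Leaves |Leaves| (steinerDist-spec Leaves))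
                 (maximal (leaf zero) e ecc))

  equality : ∀ m {D R} → 2 + m ≤ n → 2 + m ≤ a + b →
                    IsSteinerDiam T (2 + m) D → IsSteinerRad T (2 + m) 2 R → m * D + 2 ≡ (2 + m) * R
  equality m {D} {R} k≤n k≤a+b diam rad = ≤-antisym (steiner-inequality T tree m k≤n diam rad) (begin
    (2 + m) * R                   ≤⟨ *-monoʳ-≤ (2 + m) (radius-bound m k≤n rad) ⟩
    (2 + m) * (1 + x * m)         ≡⟨ rearrange m x ⟩
    m * (1 + (2 + m) * x) + 2     ≤⟨ +-monoˡ-≤ 2 (*-monoʳ-≤ m (LegWindow.diameter-bound m k≤a+b k≤n diam)) ⟩
    m * D + 2                     ∎)
    where
    open ≤-Reasoning
    rearrange : ∀ m x → (2 + m) * (1 + x * m) ≡ m * (1 + (2 + m) * x) + 2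
    rearrange = solve-∀

theorem4p4 : ∀ (n k : ℕ) → 3 ≤ k → k ≤ n → (T : Graph n) → IsTree T →
    (∀ D R → IsSteinerDiam T k D → IsSteinerRad T k 2 R →
      (k ∸ 2) * D + 2 ≤ k * R)
    × (∀ (a b x : ℕ) → 1 ≤ a → 1 ≤ b → 1 ≤ x → n ≡ 2 + (a + b) * x → k ≤ a + b →
      Iso T (P2 a b x) →
      ∀ D R → IsSteinerDiam T k D → IsSteinerRad T k 2 R →
        (k ∸ 2) * D + 2 ≡ k * R)
theorem4p4 n zero          ()
theorem4p4 n (suc zero)    (s≤s ())
theorem4p4 n (suc (suc j)) _ k≤n T tree =
    (λ D R → steiner-inequality T tree j k≤n)
  , λ { zero _ _ () ; (suc _) zero _ _ () ; (suc _) (suc _) zero _ _ ()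
      -- the order condition n ≡ 2 + (a + b) * x is implied by the isomorphism and not needed
      ; (suc a′) (suc b′) (suc x′) _ _ _ _ k≤a+b iso D R → DoubleSpider.equality a′ b′ x′ T tree iso j k≤n k≤a+b }
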